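{- Let $\lambda\in\mathbf{k}$. The twisted algebra $\mathrm{ADF}\otimes\mathrm{ADF}\otimes\mathrm{ADF}$ is a Rota–Baxter species of weight $\lambda$ with the operator $R^{(3)}$ defined, for $F\otimes G\otimes H\in\mathrm{ADF}[X_1]\otimes\mathrm{ADF}[X_2]\otimes\mathrm{ADF}[X\setminus(X_1\sqcup X_2)]$, by $R^{(3)}_X(F\otimes G\otimes H)=R_{X_1}(F)\otimes G\otimes H+\epsilon_{X_1}(F)\bullet\otimes R_{X_2}(G)\otimes H+\epsilon_{X_1}(F)\bullet\otimes\epsilon_{X_2}(G)\bullet\otimes R_{X\setminus(X_1\sqcup X_2)}(H)$.
   Context: $\mathbf{k}$ is a field of characteristic zero. Species: functors from finite sets with bijections to $\mathbf{k}$-vector spaces. Cauchy product: $(P\otimes Q)[X]=\bigoplus_{X_1\sqcup X_2=X}P[X_1]\otimes Q[X_2]$. A twisted algebra is a species with natural, associative, unital products $m_{X,Y}:P[X]\otimes P[Y]\to P[X\sqcup Y]$. A Rota–Baxter species of weight $\lambda$ is a twisted algebra with a morphism of species $R$ such that $m_{X,Y}(R_Xx\otimes R_Yy)=R_{X\sqcup Y}m_{X,Y}(R_Xx\otimes y+x\otimes R_Yy+\lambda x\otimes y)$. For a finite set $X$, $\mathrm{ADF}[X]$ has basis the planar rooted forests with exactly $|X|$ angles (gaps between consecutive leaves left to right, inside a tree or between adjacent trees) decorated bijectively by $X$; forests are written $T_1x_1\cdots x_mT_{m+1}$; $\bullet$ is the one-vertex tree. $R_X=B^+$ adds a new root joined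 to all roots. The product $\diamond$ (weight $\lambda$) is defined bilinearly by induction on depth: for trees $\bullet\diamond T'=T'$, $T\diamond\bullet=T$, $B^+(A)\diamond B^+(A')=B^+(B^+(A)\diamond A')+B^+(A\diamond B^+(A'))+\lambda B^+(A\diamond A')$; for forests $F=T_1x_1\cdots x_mT_{m+1}$, $G=T'_1y_1\cdots y_nT'_{n+1}$, $F\diamond G=T_1x_1\cdots x_m(T_{m+1}\diamond T'_1)y_1\cdots y_nT'_{n+1}$. $\mathrm{ADF}$ is a twisted algebra with product $\diamond$ and unit $\bullet$, and $\mathrm{ADF}^{\otimes3}$ is the twisted algebra with componentwise product $(F_1\otimes G_1\otimes H_1)(F_2\otimes G_2\otimes H_2)=(F_1\diamond F_2)\otimes(G_1\diamond G_2)\otimes(H_1\diamond H_2)$. The maps $\epsilon_X:\mathrm{ADF}[X]\to\mathbf{k}$ are $\epsilon_\emptyset(\bullet)=1$ and $\epsilon_X(F)=0$ for every other basis forest; $\epsilon_{X_i}(\cdot)\bullet$ is zero unless $X_i=\emptyset$. -}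

module Defs where

open import Level using (Level; _⊔_)
open import Data.Nat using (ℕ; zero; suc)
import Data.Nat as ℕ
open import Data.Product using (_×_; _,_; ∃)
open import Data.List using (List; []; _∷_; _++_; map; concatMap; foldr)
open import Data.List.Relation.Unary.All using (All)
open import Data.List.Relation.Unary.Unique.Propositional using (Unique)
open import Data.List.Relation.Binary.Permutation.Propositional using (_↭_)
open import Relation.Binary.PropositionalEquality using (_≡_; refl; cong; cong₂)
open import Relation.Nullary using (¬_; Dec; yes; no)
open import Algebra.Bundles using (CommutativeRing)

natK : {c ℓ : Level} (K : CommutativeRing c ℓ) → ℕ → CommutativeRing.Carrier K
natK K zero    = CommutativeRing.0# K
natK K (suc n) = CommutativeRing._+_ K (CommutativeRing.1# K) (natK K n)

record IsFieldChar0 {c ℓ : Level} (K : CommutativeRing c ℓ) : Set (c ⊔ ℓ) where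
  open CommutativeRing K
  field
    nontrivial : ¬ (1# ≈ 0#)
    inverse    : ∀ x → ¬ (x ≈ 0#) → ∃ λ y → (x * y) ≈ 1#
    charZero   : ∀ n → natK K n ≈ 0# → n ≡ 0

-- Labels (elements of the finite sets X) are natural numbers; a finite
-- set X is a duplicate-free list of labels.
-- A forest T₁ x₁ T₂ … xₘ Tₘ₊₁ is a nonempty sequence of trees with a
-- label on each gap between adjacent trees.

mutual
  data Tree : Set where
    leaf : Tree
    node : Forest → Tree

  data Forest : Set where
    one  : Tree → Forest
    cons : Tree → ℕ → Forest → Forest

• : Forest
• = one leaf

B⁺ : Forest → Forest
B⁺ F = one (node F)

mutual
  labelsT : Tree → List ℕ
  labelsT leaf     = []
  labelsT (node F) = labelsF F

  labelsF : Forest → List ℕ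
  labelsF (one T)      = labelsT T
  labelsF (cons T x F) = labelsT T ++ (x ∷ labelsF F)

mutual
  _≟T_ : (s t : Tree) → Dec (s ≡ t)
  leaf ≟T leaf = yes refl
  leaf ≟T node _ = no λ ()
  node _ ≟T leaf = no λ ()
  node F ≟T node G with F ≟F G
  ... | yes refl = yes refl
  ... | no ne = no λ { refl → ne refl }

  _≟F_ : (F G : Forest) → Dec (F ≡ G)
  one s ≟F one t with s ≟T t
  ... | yes refl = yes refl
  ... | no ne = no λ { refl → ne refl }
  one _ ≟F cons _ _ _ = no λ ()
  cons _ _ _ ≟F one _ = no λ ()
  cons s x F ≟F cons t y G with s ≟T t | x ℕ.≟ y | F ≟F G
  ... | yes refl | yes refl | yes refl = yes refl
  ... | no ne | _ | _ = no λ { refl → ne refl }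
  ... | yes _ | no ne | _ = no λ { refl → ne refl }
  ... | yes _ | yes _ | no ne = no λ { refl → ne refl }

Triple : Set
Triple = Forest × Forest × Forest

_≟3_ : (a b : Triple) → Dec (a ≡ b)
(F , G , H) ≟3 (F' , G' , H') with F ≟F F' | G ≟F G' | H ≟F H'
... | yes refl | yes refl | yes refl = yes refl
... | no ne | _ | _ = no λ { refl → ne refl }
... | yes _ | no ne | _ = no λ { refl → ne refl }
... | yes _ | yes _ | no ne = no λ { refl → ne refl }

labels3 : Triple → List ℕ
labels3 (F , G , H) = labelsF F ++ labelsF G ++ labelsF H

mutual
  relabelT : (ℕ → ℕ) → Tree → Tree
  relabelT σ leaf     = leaf
  relabelT σ (node F) = node (relabelF σ F)

  relabelF : (ℕ → ℕ) → Forest → Forest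
  relabelF σ (one T)      = one (relabelT σ T)
  relabelF σ (cons T x F) = cons (relabelT σ T) (σ x) (relabelF σ F)

relabel3 : (ℕ → ℕ) → Triple → Triple
relabel3 σ (F , G , H) = relabelF σ F , relabelF σ G , relabelF σ H

module ADF {c ℓ : Level} (K : CommutativeRing c ℓ) (w : CommutativeRing.Carrier K) where
  open CommutativeRing K

  -- finite formal linear combinations of basis elements of B,
  -- i.e. elements of the vector space with basis B
  Lin : Set → Set c
  Lin B = List (Carrier × B)

  basis : {B : Set} → B → Lin B
  basis b = (1# , b) ∷ []

  scale : {B : Set} → Carrier → Lin B → Lin B
  scale a = map (λ { (k , b) → (a * k , b) })

  lmap : {B C : Set} → (B → C) → Lin B → Lin C
  lmap f = map (λ { (k , b) → (k , f b) })

  linExt : {B C : Set} → (B → Lin C) → Lin B → Lin C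
  linExt f = concatMap (λ { (k , b) → scale k (f b) })

  bilin : {B C D : Set} → (B → C → Lin D) → Lin B → Lin C → Lin D
  bilin f xs ys = concatMap (λ { (k , b) → concatMap (λ { (l , c) → scale (k * l) (f b c) }) ys }) xs

  coeff : {B : Set} → ((a b : B) → Dec (a ≡ b)) → B → Lin B → Carrier
  coeff eq b [] = 0#
  coeff eq b ((k , b') ∷ xs) with eq b' b
  ... | yes _ = k + coeff eq b xs
  ... | no _  = coeff eq b xs

  _≈3_ : Lin Triple → Lin Triple → Set ℓ
  xs ≈3 ys = ∀ b → coeff _≟3_ b xs ≈ coeff _≟3_ b ys

  mutual
    _⋄T_ : Tree → Tree → Lin Tree
    leaf ⋄T t = basis t
    node A ⋄T leaf = basis (node A)
    node A ⋄T node A' =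
      lmap node (node A ⋄TF A')
      ++ lmap node (A ⋄FT node A')
      ++ scale w (lmap node (A ⋄F A'))

    _⋄TF_ : Tree → Forest → Lin Forest
    t ⋄TF one t'        = lmap one (t ⋄T t')
    t ⋄TF cons t' y G   = lmap (λ s → cons s y G) (t ⋄T t')

    _⋄FT_ : Forest → Tree → Lin Forest
    one t ⋄FT t'        = lmap one (t ⋄T t')
    cons t x F ⋄FT t'   = lmap (cons t x) (F ⋄FT t')

    -- T₁x₁⋯xₘTₘ₊₁ ⋄ T'₁y₁⋯yₙT'ₙ₊₁ = T₁x₁⋯xₘ(Tₘ₊₁⋄T'₁)y₁⋯yₙT'ₙ₊₁
    _⋄F_ : Forest → Forest → Lin Forest
    one t ⋄F G        = t ⋄TF G
    cons t x F ⋄F G   = lmap (cons t x) (F ⋄F G)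

  _⋄3_ : Triple → Triple → Lin Triple
  (F₁ , G₁ , H₁) ⋄3 (F₂ , G₂ , H₂) =
    bilin (λ F GH → basis (F , GH)) (F₁ ⋄F F₂)
      (bilin (λ G H → basis (G , H)) (G₁ ⋄F G₂) (H₁ ⋄F H₂))

  mult3 : Lin Triple → Lin Triple → Lin Triple
  mult3 = bilin _⋄3_

  ε : Forest → Carrier
  ε F with F ≟F •
  ... | yes _ = 1#
  ... | no _  = 0#

  R3basis : Triple → Lin Triple
  R3basis (F , G , H) =
    (1# , (B⁺ F , G , H))
    ∷ (ε F , (• , B⁺ G , H))
    ∷ (ε F * ε G , (• , • , B⁺ H))
    ∷ []

  R3 : Lin Triple → Lin Triple
  R3 = linExt R3basis

  -- x ∈ (ADF⊗ADF⊗ADF)[X]: every term is a triple F⊗G⊗H whose angle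
  -- decorations are bijectively X (X₁ ⊔ X₂ ⊔ X₃ = X)
  InComponent : List ℕ → Lin Triple → Set c
  InComponent X xs = All (λ { (k , t) → labels3 t ↭ X }) xs

{-# OPTIONS --safe #-}
-- Linear combinations are compared through all linear functionals ⟨ φ ∣ _ ⟩, so that every
-- identity between (bi)linear expressions reduces to one between their values on basis elements.
-- R⁽³⁾ is the two-factor operator R (a ⊗ c) = R₁ a ⊗ c + ε₁(a) 𝟙 ⊗ R₂ c applied to
-- ADF ⊗ (ADF ⊗ ADF). That operator is Rota–Baxter of weight w as soon as R₁ and R₂ are, 𝟙 is a
-- unit and ε₁ is multiplicative with ε₁ ∘ R₁ = 0: on basis tensors, the identity for R₁ produces
-- the terms R₁(…) ⊗ c c', the identity for R₂ the terms 𝟙 ⊗ R₂(…), and the remaining terms match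
-- because ε₁ is multiplicative and vanishes on the image of R₁. Since ε₁ ⊗ ε₂ has the same two
-- properties, the construction iterates. For ADF itself the identity is the recursive clause
-- defining B⁺(A) ⋄ B⁺(A'), and ε vanishes on every forest other than •.
module Submission where

open import Defs
open import Level using (Level; _⊔_)
open import Data.Nat using (ℕ)
open import Data.Product using (_×_; _,_; proj₁; proj₂)
open import Data.List using (List; map; _++_; []; _∷_; concatMap)
open import Data.List.Relation.Unary.Unique.Propositional using (Unique)
open import Data.List.Relation.Binary.Permutation.Propositional using (_↭_)
open import Algebra.Bundles using (CommutativeRing)
import Algebra.Properties.CommutativeSemigroup as CommutativeSemigroupProperties
import Algebra.Solver.Ring.NaturalCoefficients.Default as NaturalCoefficients
open import Relation.Binary.Bundles using (Setoid)
import Relation.Binary.PropositionalEquality as ≡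
import Relation.Binary.Reasoning.Setoid as SetoidReasoning
open import Data.List.Properties using (concatMap-++; ++-identityʳ)
open import Relation.Nullary using (yes; no)

module _ {c ℓ : Level} (K : CommutativeRing c ℓ) (w : CommutativeRing.Carrier K) where
  open CommutativeRing K
  open ADF K w
  open NaturalCoefficients commutativeSemiring using (solve; _:=_; _:+_; _:*_; con)
  open CommutativeSemigroupProperties +-commutativeSemigroup using () renaming (interchange to +-interchange)
  open CommutativeSemigroupProperties *-commutativeSemigroup using (x∙yz≈y∙xz) renaming (interchange to *-interchange)

  ⟨_∣_⟩ : {B : Set} → (B → Carrier) → Lin B → Carrier
  ⟨ φ ∣ [] ⟩           = 0#
  ⟨ φ ∣ (k , b) ∷ xs ⟩ = k * φ b + ⟨ φ ∣ xs ⟩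

  infix 4 _≃_
  record _≃_ {B : Set} (xs ys : Lin B) : Set (c ⊔ ℓ) where
    constructor by-pairing
    field at : ∀ φ → ⟨ φ ∣ xs ⟩ ≈ ⟨ φ ∣ ys ⟩
  open _≃_ public

  ≃-setoid : Set → Setoid c (c ⊔ ℓ)
  ≃-setoid B = record
    { Carrier       = Lin B
    ; _≈_           = _≃_
    ; isEquivalence = record
      { refl  = by-pairing λ φ → refl
      ; sym   = λ p → by-pairing λ φ → sym (at p φ)
      ; trans = λ p q → by-pairing λ φ → trans (at p φ) (at q φ)
      }
    }

  module _ {B : Set} where
    pairing-++ : (φ : B → Carrier) (xs ys : Lin B) → ⟨ φ ∣ xs ++ ys ⟩ ≈ ⟨ φ ∣ xs ⟩ + ⟨ φ ∣ ys ⟩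
    pairing-++ φ []             ys = sym (+-identityˡ _)
    pairing-++ φ ((k , b) ∷ xs) ys = trans (+-congˡ (pairing-++ φ xs ys)) (sym (+-assoc _ _ _))

    pairing-scale : (φ : B → Carrier) (a : Carrier) (xs : Lin B) → ⟨ φ ∣ scale a xs ⟩ ≈ a * ⟨ φ ∣ xs ⟩
    pairing-scale φ a []             = sym (zeroʳ a)
    pairing-scale φ a ((k , b) ∷ xs) =
      trans (+-cong (*-assoc a k (φ b)) (pairing-scale φ a xs)) (sym (distribˡ a _ _))

    pairing-basis : (φ : B → Carrier) (b : B) → ⟨ φ ∣ basis b ⟩ ≈ φ b
    pairing-basis φ b = trans (+-identityʳ _) (*-identityˡ _)

    pairing-cong : {φ ψ : B → Carrier} → (∀ b → φ b ≈ ψ b) → (xs : Lin B) → ⟨ φ ∣ xs ⟩ ≈ ⟨ ψ ∣ xs ⟩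
    pairing-cong φ≈ψ []             = refl
    pairing-cong φ≈ψ ((k , b) ∷ xs) = +-cong (*-congˡ (φ≈ψ b)) (pairing-cong φ≈ψ xs)

    pairing-zero : (xs : Lin B) → ⟨ (λ _ → 0#) ∣ xs ⟩ ≈ 0#
    pairing-zero []             = refl
    pairing-zero ((k , b) ∷ xs) = trans (+-cong (zeroʳ k) (pairing-zero xs)) (+-identityˡ 0#)

    pairing-+ : (φ ψ : B → Carrier) (xs : Lin B) →
      ⟨ (λ b → φ b + ψ b) ∣ xs ⟩ ≈ ⟨ φ ∣ xs ⟩ + ⟨ ψ ∣ xs ⟩
    pairing-+ φ ψ []             = sym (+-identityˡ 0#)
    pairing-+ φ ψ ((k , b) ∷ xs) =
      trans (+-cong (distribˡ k (φ b) (ψ b)) (pairing-+ φ ψ xs)) (+-interchange _ _ _ _)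

    pairing-*ˡ : (a : Carrier) (φ : B → Carrier) (xs : Lin B) → ⟨ (λ b → a * φ b) ∣ xs ⟩ ≈ a * ⟨ φ ∣ xs ⟩
    pairing-*ˡ a φ []             = sym (zeroʳ a)
    pairing-*ˡ a φ ((k , b) ∷ xs) =
      trans (+-cong (x∙yz≈y∙xz k a (φ b)) (pairing-*ˡ a φ xs)) (sym (distribˡ a _ _))

    pairing-*ʳ : (a : Carrier) (φ : B → Carrier) (xs : Lin B) → ⟨ (λ b → φ b * a) ∣ xs ⟩ ≈ ⟨ φ ∣ xs ⟩ * a
    pairing-*ʳ a φ xs =
      trans (pairing-cong (λ b → *-comm (φ b) a) xs) (trans (pairing-*ˡ a φ xs) (*-comm a _))

    pairing-linExt : {A : Set} (φ : B → Carrier) (f : A → Lin B) (xs : Lin A) →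
      ⟨ φ ∣ linExt f xs ⟩ ≈ ⟨ (λ a → ⟨ φ ∣ f a ⟩) ∣ xs ⟩
    pairing-linExt φ f []             = refl
    pairing-linExt φ f ((k , a) ∷ xs) =
      trans (pairing-++ φ (scale k (f a)) _) (+-cong (pairing-scale φ k (f a)) (pairing-linExt φ f xs))

  rbSum : {B : Set} → Lin B → Lin B → Lin B → Lin B
  rbSum xs ys zs = xs ++ ys ++ scale w zs

  module _ {B : Set} (φ : B → Carrier) where
    pairing-++-scale : (xs : Lin B) (s : Carrier) (ys : Lin B) →
      ⟨ φ ∣ xs ++ scale s ys ⟩ ≈ ⟨ φ ∣ xs ⟩ + s * ⟨ φ ∣ ys ⟩
    pairing-++-scale xs s ys = trans (pairing-++ φ xs (scale s ys)) (+-congˡ (pairing-scale φ s ys))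

    pairing-rbSum : (xs ys zs : Lin B) →
      ⟨ φ ∣ rbSum xs ys zs ⟩ ≈ ⟨ φ ∣ xs ⟩ + (⟨ φ ∣ ys ⟩ + w * ⟨ φ ∣ zs ⟩)
    pairing-rbSum xs ys zs = trans (pairing-++ φ xs (ys ++ scale w zs)) (+-congˡ (pairing-++-scale ys w zs))

  pairing-linear : {B : Set} (φ ψ χ : B → Carrier) (xs : Lin B) →
    ⟨ (λ b → φ b + (ψ b + w * χ b)) ∣ xs ⟩ ≈ ⟨ φ ∣ xs ⟩ + (⟨ ψ ∣ xs ⟩ + w * ⟨ χ ∣ xs ⟩)
  pairing-linear φ ψ χ xs =
    trans (pairing-+ φ (λ b → ψ b + w * χ b) xs)
      (+-congˡ (trans (pairing-+ ψ (λ b → w * χ b) xs) (+-congˡ (pairing-*ˡ w χ xs))))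

  pairing-lmap : {A B : Set} (φ : B → Carrier) (g : A → B) (xs : Lin A) →
    ⟨ φ ∣ lmap g xs ⟩ ≡.≡ ⟨ (λ a → φ (g a)) ∣ xs ⟩
  pairing-lmap φ g []             = ≡.refl
  pairing-lmap φ g ((k , a) ∷ xs) = ≡.cong (k * φ (g a) +_) (pairing-lmap φ g xs)

  pairing-bilin : {A B D : Set} (φ : D → Carrier) (f : A → B → Lin D) (xs : Lin A) (ys : Lin B) →
    ⟨ φ ∣ bilin f xs ys ⟩ ≈ ⟨ (λ a → ⟨ (λ b → ⟨ φ ∣ f a b ⟩) ∣ ys ⟩) ∣ xs ⟩
  pairing-bilin φ f []             ys = refl
  pairing-bilin φ f ((k , a) ∷ xs) ys =
    trans (pairing-++ φ (row ys) _) (+-cong (pairing-row ys) (pairing-bilin φ f xs ys))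
    where
    row : Lin _ → Lin _
    row = concatMap (λ { (l , b) → scale (k * l) (f a b) })
    pairing-row : ∀ ys → ⟨ φ ∣ row ys ⟩ ≈ k * ⟨ (λ b → ⟨ φ ∣ f a b ⟩) ∣ ys ⟩
    pairing-row []             = sym (zeroʳ k)
    pairing-row ((l , b) ∷ ys) =
      trans (pairing-++ φ (scale (k * l) (f a b)) (row ys))
        (trans (+-cong (trans (pairing-scale φ (k * l) (f a b)) (*-assoc k l _)) (pairing-row ys))
          (sym (distribˡ k _ _)))

  pairing-swap : {A B : Set} (g : A → B → Carrier) (xs : Lin A) (ys : Lin B) →
    ⟨ (λ a → ⟨ g a ∣ ys ⟩) ∣ xs ⟩ ≈ ⟨ (λ b → ⟨ (λ a → g a b) ∣ xs ⟩) ∣ ys ⟩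
  pairing-swap g []             ys = sym (pairing-zero ys)
  pairing-swap g ((k , a) ∷ xs) ys =
    trans (+-cong (sym (pairing-*ˡ k (g a) ys)) (pairing-swap g xs ys)) (sym (pairing-+ _ _ ys))

  module _ {B : Set} where
    open Setoid (≃-setoid B) public using () renaming (refl to ≃-refl; sym to ≃-sym; trans to ≃-trans)

  module ≃-Reasoning {B : Set} = SetoidReasoning (≃-setoid B)

  ++-cong : {B : Set} {xs xs' ys ys' : Lin B} → xs ≃ xs' → ys ≃ ys' → xs ++ ys ≃ xs' ++ ys'
  ++-cong {xs = xs} {xs'} {ys} {ys'} p q = by-pairing λ φ →
    trans (pairing-++ φ xs ys) (trans (+-cong (at p φ) (at q φ)) (sym (pairing-++ φ xs' ys')))

  ++-congʳ : {B : Set} (xs : Lin B) {ys ys' : Lin B} → ys ≃ ys' → xs ++ ys ≃ xs ++ ys'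
  ++-congʳ xs = ++-cong (≃-refl {x = xs})

  scale-cong : {B : Set} (a : Carrier) {xs ys : Lin B} → xs ≃ ys → scale a xs ≃ scale a ys
  scale-cong a {xs} {ys} p = by-pairing λ φ →
    trans (pairing-scale φ a xs) (trans (*-congˡ (at p φ)) (sym (pairing-scale φ a ys)))

  module _ {A B : Set} where
    linExt-cong : {f g : A → Lin B} → (∀ a → f a ≃ g a) → (xs : Lin A) → linExt f xs ≃ linExt g xs
    linExt-cong {f} {g} f≃g xs = by-pairing λ φ →
      trans (pairing-linExt φ f xs) (trans (pairing-cong (λ a → at (f≃g a) φ) xs) (sym (pairing-linExt φ g xs)))

    linExt-congʳ : (f : A → Lin B) {xs ys : Lin A} → xs ≃ ys → linExt f xs ≃ linExt f ys
    linExt-congʳ f {xs} {ys} xs≃ys = by-pairing λ φ →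
      trans (pairing-linExt φ f xs) (trans (at xs≃ys _) (sym (pairing-linExt φ f ys)))

    linExt-extends : (f : A → Lin B) (a : A) → linExt f (basis a) ≃ f a
    linExt-extends f a = by-pairing λ φ → trans (pairing-linExt φ f (basis a)) (pairing-basis (λ a' → ⟨ φ ∣ f a' ⟩) a)

  linExt-basis : {B : Set} (xs : Lin B) → linExt basis xs ≃ xs
  linExt-basis xs = by-pairing λ φ → trans (pairing-linExt φ basis xs) (pairing-cong (pairing-basis φ) xs)

  module _ {A B D : Set} where
    bilin-cong : {f g : A → B → Lin D} → (∀ a b → f a b ≃ g a b) → (xs : Lin A) (ys : Lin B) →
      bilin f xs ys ≃ bilin g xs ys
    bilin-cong {f} {g} f≃g xs ys = by-pairing λ φ →
      trans (pairing-bilin φ f xs ys)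
        (trans (pairing-cong (λ a → pairing-cong (λ b → at (f≃g a b) φ) ys) xs) (sym (pairing-bilin φ g xs ys)))

    bilin-congˡ : (f : A → B → Lin D) {xs xs' : Lin A} (ys : Lin B) → xs ≃ xs' → bilin f xs ys ≃ bilin f xs' ys
    bilin-congˡ f {xs} {xs'} ys xs≃xs' = by-pairing λ φ →
      trans (pairing-bilin φ f xs ys) (trans (at xs≃xs' _) (sym (pairing-bilin φ f xs' ys)))

    bilin-congʳ : (f : A → B → Lin D) (xs : Lin A) {ys ys' : Lin B} → ys ≃ ys' → bilin f xs ys ≃ bilin f xs ys'
    bilin-congʳ f xs {ys} {ys'} ys≃ys' = by-pairing λ φ →
      trans (pairing-bilin φ f xs ys)
        (trans (pairing-cong (λ a → at ys≃ys' _) xs) (sym (pairing-bilin φ f xs ys')))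

    bilin-map-rbSum : (f g h : A → B → Lin D) (xs : Lin A) (ys : Lin B) →
      bilin (λ a b → rbSum (f a b) (g a b) (h a b)) xs ys ≃ rbSum (bilin f xs ys) (bilin g xs ys) (bilin h xs ys)
    bilin-map-rbSum f g h xs ys = by-pairing λ φ → begin
      ⟨ φ ∣ bilin (λ a b → rbSum (f a b) (g a b) (h a b)) xs ys ⟩
        ≈⟨ pairing-bilin φ (λ a b → rbSum (f a b) (g a b) (h a b)) xs ys ⟩
      ⟨ (λ a → ⟨ (λ b → ⟨ φ ∣ rbSum (f a b) (g a b) (h a b) ⟩) ∣ ys ⟩) ∣ xs ⟩
        ≈⟨ pairing-cong (λ a → trans (pairing-cong (λ b → pairing-rbSum φ (f a b) (g a b) (h a b)) ys)
                                     (pairing-linear (value φ f a) (value φ g a) (value φ h a) ys)) xs ⟩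
      ⟨ (λ a → ⟨ value φ f a ∣ ys ⟩ + (⟨ value φ g a ∣ ys ⟩ + w * ⟨ value φ h a ∣ ys ⟩)) ∣ xs ⟩
        ≈⟨ pairing-linear (λ a → ⟨ value φ f a ∣ ys ⟩) (λ a → ⟨ value φ g a ∣ ys ⟩)
                          (λ a → ⟨ value φ h a ∣ ys ⟩) xs ⟩
      ⟨ (λ a → ⟨ value φ f a ∣ ys ⟩) ∣ xs ⟩
        + (⟨ (λ a → ⟨ value φ g a ∣ ys ⟩) ∣ xs ⟩ + w * ⟨ (λ a → ⟨ value φ h a ∣ ys ⟩) ∣ xs ⟩)
        ≈⟨ sym (+-cong (pairing-bilin φ f xs ys) (+-cong (pairing-bilin φ g xs ys) (*-congˡ (pairing-bilin φ h xs ys)))) ⟩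
      ⟨ φ ∣ bilin f xs ys ⟩ + (⟨ φ ∣ bilin g xs ys ⟩ + w * ⟨ φ ∣ bilin h xs ys ⟩)
        ≈⟨ sym (pairing-rbSum φ (bilin f xs ys) (bilin g xs ys) (bilin h xs ys)) ⟩
      ⟨ φ ∣ rbSum (bilin f xs ys) (bilin g xs ys) (bilin h xs ys) ⟩
        ∎
      where
      open SetoidReasoning setoid
      value : (D → Carrier) → (A → B → Lin D) → A → B → Carrier
      value φ k a b = ⟨ φ ∣ k a b ⟩

    bilin-basis : (f : A → B → Lin D) (a : A) (b : B) → bilin f (basis a) (basis b) ≃ f a b
    bilin-basis f a b = by-pairing λ φ →
      trans (pairing-bilin φ f (basis a) (basis b))
        (trans (pairing-basis (λ a' → ⟨ (λ b' → ⟨ φ ∣ f a' b' ⟩) ∣ basis b ⟩) a)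
               (pairing-basis (λ b' → ⟨ φ ∣ f a b' ⟩) b))

    bilin-basisˡ : (f : A → B → Lin D) (a : A) (ys : Lin B) → bilin f (basis a) ys ≃ linExt (f a) ys
    bilin-basisˡ f a ys = by-pairing λ φ →
      trans (pairing-bilin φ f (basis a) ys)
        (trans (pairing-basis (λ a' → ⟨ (λ b → ⟨ φ ∣ f a' b ⟩) ∣ ys ⟩) a) (sym (pairing-linExt φ (f a) ys)))

    bilin-basisʳ : (f : A → B → Lin D) (xs : Lin A) (b : B) → bilin f xs (basis b) ≃ linExt (λ a → f a b) xs
    bilin-basisʳ f xs b = by-pairing λ φ →
      trans (pairing-bilin φ f xs (basis b))
        (trans (pairing-cong (λ a → pairing-basis (λ b' → ⟨ φ ∣ f a b' ⟩) b) xs) (sym (pairing-linExt φ (λ a → f a b) xs)))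

  module _ {A B A' B' D : Set} where
    bilin-linExt : (f : A → B → Lin D) (g : A' → Lin A) (h : B' → Lin B) (xs : Lin A') (ys : Lin B') →
      bilin f (linExt g xs) (linExt h ys) ≃ bilin (λ a b → bilin f (g a) (h b)) xs ys
    bilin-linExt f g h xs ys = by-pairing λ φ → begin
      ⟨ φ ∣ bilin f (linExt g xs) (linExt h ys) ⟩
        ≈⟨ pairing-bilin φ f (linExt g xs) (linExt h ys) ⟩
      ⟨ (λ a → ⟨ (λ b → ⟨ φ ∣ f a b ⟩) ∣ linExt h ys ⟩) ∣ linExt g xs ⟩
        ≈⟨ pairing-cong (λ a → pairing-linExt (λ b → ⟨ φ ∣ f a b ⟩) h ys) (linExt g xs) ⟩
      ⟨ (λ a → ⟨ (λ b' → ⟨ (λ b → ⟨ φ ∣ f a b ⟩) ∣ h b' ⟩) ∣ ys ⟩) ∣ linExt g xs ⟩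
        ≈⟨ pairing-linExt _ g xs ⟩
      ⟨ (λ a' → ⟨ (λ a → ⟨ (λ b' → ⟨ (λ b → ⟨ φ ∣ f a b ⟩) ∣ h b' ⟩) ∣ ys ⟩) ∣ g a' ⟩) ∣ xs ⟩
        ≈⟨ pairing-cong (λ a' → pairing-swap (λ a b' → ⟨ (λ b → ⟨ φ ∣ f a b ⟩) ∣ h b' ⟩) (g a') ys) xs ⟩
      ⟨ (λ a' → ⟨ (λ b' → ⟨ (λ a → ⟨ (λ b → ⟨ φ ∣ f a b ⟩) ∣ h b' ⟩) ∣ g a' ⟩) ∣ ys ⟩) ∣ xs ⟩
        ≈⟨ sym (trans (pairing-bilin φ (λ a b → bilin f (g a) (h b)) xs ys)
                      (pairing-cong (λ a' → pairing-cong (λ b' → pairing-bilin φ f (g a') (h b')) ys) xs)) ⟩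
      ⟨ φ ∣ bilin (λ a b → bilin f (g a) (h b)) xs ys ⟩
        ∎
      where open SetoidReasoning setoid

  module _ {A B D E : Set} where
    linExt-bilin : (g : D → Lin E) (f : A → B → Lin D) (xs : Lin A) (ys : Lin B) →
      linExt g (bilin f xs ys) ≃ bilin (λ a b → linExt g (f a b)) xs ys
    linExt-bilin g f xs ys = by-pairing λ φ → begin
      ⟨ φ ∣ linExt g (bilin f xs ys) ⟩
        ≈⟨ pairing-linExt φ g (bilin f xs ys) ⟩
      ⟨ (λ d → ⟨ φ ∣ g d ⟩) ∣ bilin f xs ys ⟩
        ≈⟨ pairing-bilin (λ d → ⟨ φ ∣ g d ⟩) f xs ys ⟩
      ⟨ (λ a → ⟨ (λ b → ⟨ (λ d → ⟨ φ ∣ g d ⟩) ∣ f a b ⟩) ∣ ys ⟩) ∣ xs ⟩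
        ≈⟨ sym (trans (pairing-bilin φ (λ a b → linExt g (f a b)) xs ys)
                      (pairing-cong (λ a → pairing-cong (λ b → pairing-linExt φ g (f a b)) ys) xs)) ⟩
      ⟨ φ ∣ bilin (λ a b → linExt g (f a b)) xs ys ⟩
        ∎
      where open SetoidReasoning setoid

  scale-zero : {B : Set} {s : Carrier} (xs : Lin B) → s ≈ 0# → scale s xs ≃ []
  scale-zero {s = s} xs s≈0 = by-pairing λ φ →
    trans (pairing-scale φ s xs) (trans (*-congʳ s≈0) (zeroˡ _))

  module _ {A B : Set} where
    linExt-++ : (f : A → Lin B) (xs ys : Lin A) → linExt f (xs ++ ys) ≡.≡ linExt f xs ++ linExt f ys
    linExt-++ f = concatMap-++ _

    linExt-scale : (f : A → Lin B) (s : Carrier) (xs : Lin A) → linExt f (scale s xs) ≃ scale s (linExt f xs)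
    linExt-scale f s xs = by-pairing λ φ → begin
      ⟨ φ ∣ linExt f (scale s xs) ⟩          ≈⟨ pairing-linExt φ f (scale s xs) ⟩
      ⟨ (λ a → ⟨ φ ∣ f a ⟩) ∣ scale s xs ⟩   ≈⟨ pairing-scale (λ a → ⟨ φ ∣ f a ⟩) s xs ⟩
      s * ⟨ (λ a → ⟨ φ ∣ f a ⟩) ∣ xs ⟩       ≈⟨ *-congˡ (sym (pairing-linExt φ f xs)) ⟩
      s * ⟨ φ ∣ linExt f xs ⟩                ≈⟨ sym (pairing-scale φ s (linExt f xs)) ⟩
      ⟨ φ ∣ scale s (linExt f xs) ⟩          ∎
      where open SetoidReasoning setoid

  module _ {A B D : Set} (f : A → B → Lin D) where
    bilin-++ˡ : (xs xs' : Lin A) (ys : Lin B) → bilin f (xs ++ xs') ys ≡.≡ bilin f xs ys ++ bilin f xs' ys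
    bilin-++ˡ xs xs' ys = concatMap-++ _ xs xs'

    bilin-scaleˡ : (s : Carrier) (xs : Lin A) (ys : Lin B) → bilin f (scale s xs) ys ≃ scale s (bilin f xs ys)
    bilin-scaleˡ s xs ys = by-pairing λ φ → begin
      ⟨ φ ∣ bilin f (scale s xs) ys ⟩  ≈⟨ pairing-bilin φ f (scale s xs) ys ⟩
      ⟨ ψ φ ∣ scale s xs ⟩             ≈⟨ pairing-scale (ψ φ) s xs ⟩
      s * ⟨ ψ φ ∣ xs ⟩                 ≈⟨ *-congˡ (sym (pairing-bilin φ f xs ys)) ⟩
      s * ⟨ φ ∣ bilin f xs ys ⟩        ≈⟨ sym (pairing-scale φ s (bilin f xs ys)) ⟩
      ⟨ φ ∣ scale s (bilin f xs ys) ⟩  ∎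
      where
      open SetoidReasoning setoid
      ψ : (D → Carrier) → A → Carrier
      ψ φ a = ⟨ (λ b → ⟨ φ ∣ f a b ⟩) ∣ ys ⟩

    bilin-++ʳ : (xs : Lin A) (ys ys' : Lin B) → bilin f xs (ys ++ ys') ≃ bilin f xs ys ++ bilin f xs ys'
    bilin-++ʳ xs ys ys' = by-pairing λ φ → begin
      ⟨ φ ∣ bilin f xs (ys ++ ys') ⟩
        ≈⟨ pairing-bilin φ f xs (ys ++ ys') ⟩
      ⟨ (λ a → ⟨ ψ φ a ∣ ys ++ ys' ⟩) ∣ xs ⟩
        ≈⟨ pairing-cong (λ a → pairing-++ (ψ φ a) ys ys') xs ⟩
      ⟨ (λ a → ⟨ ψ φ a ∣ ys ⟩ + ⟨ ψ φ a ∣ ys' ⟩) ∣ xs ⟩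
        ≈⟨ pairing-+ (λ a → ⟨ ψ φ a ∣ ys ⟩) (λ a → ⟨ ψ φ a ∣ ys' ⟩) xs ⟩
      ⟨ (λ a → ⟨ ψ φ a ∣ ys ⟩) ∣ xs ⟩ + ⟨ (λ a → ⟨ ψ φ a ∣ ys' ⟩) ∣ xs ⟩
        ≈⟨ sym (+-cong (pairing-bilin φ f xs ys) (pairing-bilin φ f xs ys')) ⟩
      ⟨ φ ∣ bilin f xs ys ⟩ + ⟨ φ ∣ bilin f xs ys' ⟩
        ≈⟨ sym (pairing-++ φ (bilin f xs ys) (bilin f xs ys')) ⟩
      ⟨ φ ∣ bilin f xs ys ++ bilin f xs ys' ⟩
        ∎
      where
      open SetoidReasoning setoid
      ψ : (D → Carrier) → A → B → Carrier
      ψ φ a b = ⟨ φ ∣ f a b ⟩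

    bilin-scaleʳ : (s : Carrier) (xs : Lin A) (ys : Lin B) → bilin f xs (scale s ys) ≃ scale s (bilin f xs ys)
    bilin-scaleʳ s xs ys = by-pairing λ φ → begin
      ⟨ φ ∣ bilin f xs (scale s ys) ⟩
        ≈⟨ pairing-bilin φ f xs (scale s ys) ⟩
      ⟨ (λ a → ⟨ ψ φ a ∣ scale s ys ⟩) ∣ xs ⟩
        ≈⟨ pairing-cong (λ a → pairing-scale (ψ φ a) s ys) xs ⟩
      ⟨ (λ a → s * ⟨ ψ φ a ∣ ys ⟩) ∣ xs ⟩
        ≈⟨ pairing-*ˡ s (λ a → ⟨ ψ φ a ∣ ys ⟩) xs ⟩
      s * ⟨ (λ a → ⟨ ψ φ a ∣ ys ⟩) ∣ xs ⟩
        ≈⟨ *-congˡ (sym (pairing-bilin φ f xs ys)) ⟩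
      s * ⟨ φ ∣ bilin f xs ys ⟩
        ≈⟨ sym (pairing-scale φ s (bilin f xs ys)) ⟩
      ⟨ φ ∣ scale s (bilin f xs ys) ⟩
        ∎
      where
      open SetoidReasoning setoid
      ψ : (D → Carrier) → A → B → Carrier
      ψ φ a b = ⟨ φ ∣ f a b ⟩

  scale-congˡ : {B : Set} {s t : Carrier} → s ≈ t → (xs : Lin B) → scale s xs ≃ scale t xs
  scale-congˡ {s = s} {t} s≈t xs = by-pairing λ φ →
    trans (pairing-scale φ s xs) (trans (*-congʳ s≈t) (sym (pairing-scale φ t xs)))

  rbSum-cong : {B : Set} {xs xs' ys ys' zs zs' : Lin B} →
    xs ≃ xs' → ys ≃ ys' → zs ≃ zs' → rbSum xs ys zs ≃ rbSum xs' ys' zs'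
  rbSum-cong p q r = ++-cong p (++-cong q (scale-cong w r))

  ≡⇒≃ : {B : Set} {xs ys : Lin B} → xs ≡.≡ ys → xs ≃ ys
  ≡⇒≃ ≡.refl = ≃-refl

  linExt-rbSum : {A B : Set} (f : A → Lin B) (xs ys zs : Lin A) →
    linExt f (rbSum xs ys zs) ≃ rbSum (linExt f xs) (linExt f ys) (linExt f zs)
  linExt-rbSum f xs ys zs = begin
    linExt f (xs ++ ys ++ scale w zs)                   ≡⟨ linExt-++ f xs (ys ++ scale w zs) ⟩
    linExt f xs ++ linExt f (ys ++ scale w zs)          ≡⟨ ≡.cong (linExt f xs ++_) (linExt-++ f ys (scale w zs)) ⟩
    linExt f xs ++ linExt f ys ++ linExt f (scale w zs)
      ≈⟨ ++-congʳ (linExt f xs) (++-congʳ (linExt f ys) (linExt-scale f w zs)) ⟩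
    rbSum (linExt f xs) (linExt f ys) (linExt f zs)     ∎
    where open ≃-Reasoning

  module _ {A B D : Set} (f : A → B → Lin D) where
    bilin-rbSumˡ : (xs ys zs : Lin A) (us : Lin B) →
      bilin f (rbSum xs ys zs) us ≃ rbSum (bilin f xs us) (bilin f ys us) (bilin f zs us)
    bilin-rbSumˡ xs ys zs us = begin
      bilin f (xs ++ ys ++ scale w zs) us                   ≡⟨ bilin-++ˡ f xs (ys ++ scale w zs) us ⟩
      bilin f xs us ++ bilin f (ys ++ scale w zs) us        ≡⟨ ≡.cong (bilin f xs us ++_) (bilin-++ˡ f ys (scale w zs) us) ⟩
      bilin f xs us ++ bilin f ys us ++ bilin f (scale w zs) us
        ≈⟨ ++-congʳ (bilin f xs us) (++-congʳ (bilin f ys us) (bilin-scaleˡ f w zs us)) ⟩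
      rbSum (bilin f xs us) (bilin f ys us) (bilin f zs us) ∎
      where open ≃-Reasoning

    bilin-rbSumʳ : (us : Lin A) (xs ys zs : Lin B) →
      bilin f us (rbSum xs ys zs) ≃ rbSum (bilin f us xs) (bilin f us ys) (bilin f us zs)
    bilin-rbSumʳ us xs ys zs = begin
      bilin f us (xs ++ ys ++ scale w zs)                   ≈⟨ bilin-++ʳ f us xs (ys ++ scale w zs) ⟩
      bilin f us xs ++ bilin f us (ys ++ scale w zs)        ≈⟨ ++-congʳ (bilin f us xs) (bilin-++ʳ f us ys (scale w zs)) ⟩
      bilin f us xs ++ bilin f us ys ++ bilin f us (scale w zs)
        ≈⟨ ++-congʳ (bilin f us xs) (++-congʳ (bilin f us ys) (bilin-scaleʳ f w us zs)) ⟩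
      rbSum (bilin f us xs) (bilin f us ys) (bilin f us zs) ∎
      where open ≃-Reasoning

    bilin-expand : (xs xs' : Lin A) (s : Carrier) (ys ys' : Lin B) (t : Carrier) →
      bilin f (xs ++ scale s xs') (ys ++ scale t ys')
        ≃ (bilin f xs ys ++ scale t (bilin f xs ys')) ++ scale s (bilin f xs' ys ++ scale t (bilin f xs' ys'))
    bilin-expand xs xs' s ys ys' t = begin
      bilin f (xs ++ scale s xs') zs                  ≡⟨ bilin-++ˡ f xs (scale s xs') zs ⟩
      bilin f xs zs ++ bilin f (scale s xs') zs       ≈⟨ ++-congʳ (bilin f xs zs) (bilin-scaleˡ f s xs' zs) ⟩
      bilin f xs zs ++ scale s (bilin f xs' zs)       ≈⟨ ++-cong (expandʳ xs) (scale-cong s (expandʳ xs')) ⟩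
      (bilin f xs ys ++ scale t (bilin f xs ys')) ++ scale s (bilin f xs' ys ++ scale t (bilin f xs' ys')) ∎
      where
      open ≃-Reasoning
      zs : Lin B
      zs = ys ++ scale t ys'
      expandʳ : (us : Lin A) → bilin f us zs ≃ bilin f us ys ++ scale t (bilin f us ys')
      expandʳ us = ≃-trans (bilin-++ʳ f us ys (scale t ys')) (++-congʳ (bilin f us ys) (bilin-scaleʳ f t us ys'))

  module _ {A B : Set} where
    lmap-cong : (g : A → B) {xs ys : Lin A} → xs ≃ ys → lmap g xs ≃ lmap g ys
    lmap-cong g {xs} {ys} xs≃ys = by-pairing λ φ →
      trans (reflexive (pairing-lmap φ g xs))
        (trans (at xs≃ys (λ a → φ (g a))) (reflexive (≡.sym (pairing-lmap φ g ys))))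

    linExt-basis-lmap : (g : A → B) (xs : Lin A) → linExt (λ a → basis (g a)) xs ≃ lmap g xs
    linExt-basis-lmap g xs = by-pairing λ φ →
      trans (pairing-linExt φ (λ a → basis (g a)) xs)
        (trans (pairing-cong (λ a → pairing-basis φ (g a)) xs) (reflexive (≡.sym (pairing-lmap φ g xs))))

  linExt-natural : {B : Set} (g : B → B) (R : B → Lin B) → (∀ b → R (g b) ≃ lmap g (R b)) →
    (xs : Lin B) → linExt R (lmap g xs) ≃ lmap g (linExt R xs)
  linExt-natural g R natural xs = by-pairing λ φ → begin
    ⟨ φ ∣ linExt R (lmap g xs) ⟩                        ≈⟨ pairing-linExt φ R (lmap g xs) ⟩
    ⟨ (λ b → ⟨ φ ∣ R b ⟩) ∣ lmap g xs ⟩                 ≡⟨ pairing-lmap (λ b → ⟨ φ ∣ R b ⟩) g xs ⟩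
    ⟨ (λ b → ⟨ φ ∣ R (g b) ⟩) ∣ xs ⟩                    ≈⟨ pairing-cong (λ b → at (natural b) φ) xs ⟩
    ⟨ (λ b → ⟨ φ ∣ lmap g (R b) ⟩) ∣ xs ⟩               ≈⟨ pairing-cong (λ b → reflexive (pairing-lmap φ g (R b))) xs ⟩
    ⟨ (λ b → ⟨ (λ b' → φ (g b')) ∣ R b ⟩) ∣ xs ⟩        ≈⟨ sym (pairing-linExt (λ b' → φ (g b')) R xs) ⟩
    ⟨ (λ b' → φ (g b')) ∣ linExt R xs ⟩                 ≡⟨ ≡.sym (pairing-lmap φ g (linExt R xs)) ⟩
    ⟨ φ ∣ lmap g (linExt R xs) ⟩                        ∎
    where open SetoidReasoning setoid

  IsRotaBaxter : {B : Set} → (B → B → Lin B) → (B → Lin B) → Set (c ⊔ ℓ)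
  IsRotaBaxter _∙_ R = ∀ xs ys →
    bilin _∙_ (linExt R xs) (linExt R ys) ≃
      linExt R (rbSum (bilin _∙_ (linExt R xs) ys) (bilin _∙_ xs (linExt R ys)) (bilin _∙_ xs ys))

  IsRotaBaxterOnBasis : {B : Set} → (B → B → Lin B) → (B → Lin B) → Set (c ⊔ ℓ)
  IsRotaBaxterOnBasis _∙_ R = ∀ a b →
    bilin _∙_ (R a) (R b) ≃ linExt R (rbSum (bilin _∙_ (R a) (basis b)) (bilin _∙_ (basis a) (R b)) (a ∙ b))

  isRotaBaxter : {B : Set} {_∙_ : B → B → Lin B} {R : B → Lin B} →
    IsRotaBaxterOnBasis _∙_ R → IsRotaBaxter _∙_ R
  isRotaBaxter {_∙_ = _∙_} {R} rotaBaxter xs ys = begin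
    bilin _∙_ (linExt R xs) (linExt R ys)
      ≈⟨ bilin-linExt _∙_ R R xs ys ⟩
    bilin (λ a b → bilin _∙_ (R a) (R b)) xs ys
      ≈⟨ bilin-cong rotaBaxter xs ys ⟩
    bilin (λ a b → linExt R (rbSum (R∙ a b) (∙R a b) (a ∙ b))) xs ys
      ≈⟨ ≃-sym (linExt-bilin R (λ a b → rbSum (R∙ a b) (∙R a b) (a ∙ b)) xs ys) ⟩
    linExt R (bilin (λ a b → rbSum (R∙ a b) (∙R a b) (a ∙ b)) xs ys)
      ≈⟨ linExt-congʳ R (bilin-map-rbSum R∙ ∙R _∙_ xs ys) ⟩
    linExt R (rbSum (bilin R∙ xs ys) (bilin ∙R xs ys) (bilin _∙_ xs ys))
      ≈⟨ linExt-congʳ R (rbSum-cong (≃-sym (bilin-linExt _∙_ R basis xs ys))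
                                    (≃-sym (bilin-linExt _∙_ basis R xs ys)) ≃-refl) ⟩
    linExt R (rbSum (bilin _∙_ (linExt R xs) (linExt basis ys)) (bilin _∙_ (linExt basis xs) (linExt R ys)) (bilin _∙_ xs ys))
      ≈⟨ linExt-congʳ R (rbSum-cong (bilin-congʳ _∙_ (linExt R xs) (linExt-basis ys))
                                    (bilin-congˡ _∙_ (linExt R ys) (linExt-basis xs)) ≃-refl) ⟩
    linExt R (rbSum (bilin _∙_ (linExt R xs) ys) (bilin _∙_ xs (linExt R ys)) (bilin _∙_ xs ys))
      ∎
    where
    open ≃-Reasoning
    R∙ ∙R : _ → _ → Lin _
    R∙ a b = bilin _∙_ (R a) (basis b)
    ∙R a b = bilin _∙_ (basis a) (R b)

  isRotaBaxter-cong : {B : Set} {_∙_ : B → B → Lin B} {R R' : B → Lin B} →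
    (∀ b → R b ≃ R' b) → IsRotaBaxter _∙_ R → IsRotaBaxter _∙_ R'
  isRotaBaxter-cong {B} {_∙_} {R} {R'} R≃R' rotaBaxter xs ys = begin
    bilin _∙_ (linExt R' xs) (linExt R' ys)
      ≈⟨ ≃-trans (bilin-congˡ _∙_ (linExt R' ys) (R'≃R xs)) (bilin-congʳ _∙_ (linExt R xs) (R'≃R ys)) ⟩
    bilin _∙_ (linExt R xs) (linExt R ys)
      ≈⟨ rotaBaxter xs ys ⟩
    linExt R (rbSum (bilin _∙_ (linExt R xs) ys) (bilin _∙_ xs (linExt R ys)) (bilin _∙_ xs ys))
      ≈⟨ linExt-cong R≃R' (rbSum (bilin _∙_ (linExt R xs) ys) (bilin _∙_ xs (linExt R ys)) (bilin _∙_ xs ys)) ⟩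
    linExt R' (rbSum (bilin _∙_ (linExt R xs) ys) (bilin _∙_ xs (linExt R ys)) (bilin _∙_ xs ys))
      ≈⟨ linExt-congʳ R' (rbSum-cong (bilin-congˡ _∙_ ys (≃-sym (R'≃R xs))) (bilin-congʳ _∙_ xs (≃-sym (R'≃R ys)))
                                     (≃-refl {x = bilin _∙_ xs ys})) ⟩
    linExt R' (rbSum (bilin _∙_ (linExt R' xs) ys) (bilin _∙_ xs (linExt R' ys)) (bilin _∙_ xs ys))
      ∎
    where
    open ≃-Reasoning
    R'≃R : (zs : Lin B) → linExt R' zs ≃ linExt R zs
    R'≃R zs = linExt-cong (λ b → ≃-sym (R≃R' b)) zs

  infixr 7 _⊗_
  _⊗_ : {A C : Set} → Lin A → Lin C → Lin (A × C)
  xs ⊗ ys = bilin (λ a c → basis (a , c)) xs ys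

  module _ {A C : Set} where
    pairing-⊗ : (φ : A × C → Carrier) (xs : Lin A) (ys : Lin C) →
      ⟨ φ ∣ xs ⊗ ys ⟩ ≈ ⟨ (λ a → ⟨ (λ c → φ (a , c)) ∣ ys ⟩) ∣ xs ⟩
    pairing-⊗ φ xs ys =
      trans (pairing-bilin φ (λ a c → basis (a , c)) xs ys)
        (pairing-cong (λ a → pairing-cong (λ c → pairing-basis φ (a , c)) ys) xs)

    pairing-basis-⊗ : (φ : A × C → Carrier) (a : A) (ys : Lin C) →
      ⟨ φ ∣ basis a ⊗ ys ⟩ ≈ ⟨ (λ c → φ (a , c)) ∣ ys ⟩
    pairing-basis-⊗ φ a ys = trans (pairing-⊗ φ (basis a) ys) (pairing-basis (λ α → ⟨ (λ c → φ (α , c)) ∣ ys ⟩) a)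

    pairing-linExt-⊗ : {A' : Set} (φ : A × C → Carrier) (f : A' → Lin A) (xs : Lin A') (ys : Lin C) →
      ⟨ φ ∣ linExt f xs ⊗ ys ⟩ ≈ ⟨ (λ a → ⟨ (λ c → ⟨ (λ α → φ (α , c)) ∣ f a ⟩) ∣ ys ⟩) ∣ xs ⟩
    pairing-linExt-⊗ φ f xs ys = begin
      ⟨ φ ∣ linExt f xs ⊗ ys ⟩
        ≈⟨ pairing-⊗ φ (linExt f xs) ys ⟩
      ⟨ (λ α → ⟨ (λ c → φ (α , c)) ∣ ys ⟩) ∣ linExt f xs ⟩
        ≈⟨ pairing-linExt (λ α → ⟨ (λ c → φ (α , c)) ∣ ys ⟩) f xs ⟩
      ⟨ (λ a → ⟨ (λ α → ⟨ (λ c → φ (α , c)) ∣ ys ⟩) ∣ f a ⟩) ∣ xs ⟩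
        ≈⟨ pairing-cong (λ a → pairing-swap (λ α c → φ (α , c)) (f a) ys) xs ⟩
      ⟨ (λ a → ⟨ (λ c → ⟨ (λ α → φ (α , c)) ∣ f a ⟩) ∣ ys ⟩) ∣ xs ⟩
        ∎
      where open SetoidReasoning setoid

    pairing-⊗-product : (χ : A → Carrier) (ψ : C → Carrier) (xs : Lin A) (ys : Lin C) →
      ⟨ (λ p → χ (proj₁ p) * ψ (proj₂ p)) ∣ xs ⊗ ys ⟩ ≈ ⟨ χ ∣ xs ⟩ * ⟨ ψ ∣ ys ⟩
    pairing-⊗-product χ ψ xs ys =
      trans (pairing-⊗ (λ p → χ (proj₁ p) * ψ (proj₂ p)) xs ys)
        (trans (pairing-cong (λ a → pairing-*ˡ (χ a) ψ ys) xs) (pairing-*ʳ ⟨ ψ ∣ ys ⟩ χ xs))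

    basis-⊗ : (a : A) (c : C) → basis a ⊗ basis c ≃ basis (a , c)
    basis-⊗ = bilin-basis (λ a c → basis (a , c))

    ⊗-congˡ : {xs xs' : Lin A} (ys : Lin C) → xs ≃ xs' → xs ⊗ ys ≃ xs' ⊗ ys
    ⊗-congˡ = bilin-congˡ (λ a c → basis (a , c))

    ⊗-congʳ : (xs : Lin A) {ys ys' : Lin C} → ys ≃ ys' → xs ⊗ ys ≃ xs ⊗ ys'
    ⊗-congʳ = bilin-congʳ (λ a c → basis (a , c))

    ⊗-cong : {xs xs' : Lin A} {ys ys' : Lin C} → xs ≃ xs' → ys ≃ ys' → xs ⊗ ys ≃ xs' ⊗ ys'
    ⊗-cong {xs} {xs'} {ys} {ys'} xs≃xs' ys≃ys' =
      ≃-trans (bilin-congˡ (λ a c → basis (a , c)) ys xs≃xs') (bilin-congʳ (λ a c → basis (a , c)) xs' ys≃ys')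

  module _ {A A' C : Set} where
    ⊗-bilinˡ : (f : A' → A' → Lin A) (xs xs' : Lin A') (ys : Lin C) →
      bilin f xs xs' ⊗ ys ≃ bilin (λ a a' → f a a' ⊗ ys) xs xs'
    ⊗-bilinˡ f xs xs' ys = by-pairing λ φ → begin
      ⟨ φ ∣ bilin f xs xs' ⊗ ys ⟩
        ≈⟨ pairing-⊗ φ (bilin f xs xs') ys ⟩
      ⟨ ψ φ ∣ bilin f xs xs' ⟩
        ≈⟨ pairing-bilin (ψ φ) f xs xs' ⟩
      ⟨ (λ a → ⟨ (λ a' → ⟨ ψ φ ∣ f a a' ⟩) ∣ xs' ⟩) ∣ xs ⟩
        ≈⟨ sym (pairing-cong (λ a → pairing-cong (λ a' → pairing-⊗ φ (f a a') ys) xs') xs) ⟩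
      ⟨ (λ a → ⟨ (λ a' → ⟨ φ ∣ f a a' ⊗ ys ⟩) ∣ xs' ⟩) ∣ xs ⟩
        ≈⟨ sym (pairing-bilin φ (λ a a' → f a a' ⊗ ys) xs xs') ⟩
      ⟨ φ ∣ bilin (λ a a' → f a a' ⊗ ys) xs xs' ⟩
        ∎
      where
      open SetoidReasoning setoid
      ψ : (A × C → Carrier) → A → Carrier
      ψ φ α = ⟨ (λ c → φ (α , c)) ∣ ys ⟩

  module _ {A C C' : Set} where
    ⊗-bilinʳ : (xs : Lin A) (g : C' → C' → Lin C) (ys ys' : Lin C') →
      xs ⊗ bilin g ys ys' ≃ bilin (λ c c' → xs ⊗ g c c') ys ys'
    ⊗-bilinʳ xs g ys ys' = by-pairing λ φ → begin
      ⟨ φ ∣ xs ⊗ bilin g ys ys' ⟩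
        ≈⟨ pairing-⊗ φ xs (bilin g ys ys') ⟩
      ⟨ (λ a → ⟨ (λ γ → φ (a , γ)) ∣ bilin g ys ys' ⟩) ∣ xs ⟩
        ≈⟨ pairing-cong (λ a → pairing-bilin (λ γ → φ (a , γ)) g ys ys') xs ⟩
      ⟨ (λ a → ⟨ (λ c → ⟨ (λ c' → ψ φ a c c') ∣ ys' ⟩) ∣ ys ⟩) ∣ xs ⟩
        ≈⟨ pairing-swap (λ a c → ⟨ (λ c' → ψ φ a c c') ∣ ys' ⟩) xs ys ⟩
      ⟨ (λ c → ⟨ (λ a → ⟨ (λ c' → ψ φ a c c') ∣ ys' ⟩) ∣ xs ⟩) ∣ ys ⟩
        ≈⟨ pairing-cong (λ c → pairing-swap (λ a c' → ψ φ a c c') xs ys') ys ⟩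
      ⟨ (λ c → ⟨ (λ c' → ⟨ (λ a → ψ φ a c c') ∣ xs ⟩) ∣ ys' ⟩) ∣ ys ⟩
        ≈⟨ sym (pairing-cong (λ c → pairing-cong (λ c' → pairing-⊗ φ xs (g c c')) ys') ys) ⟩
      ⟨ (λ c → ⟨ (λ c' → ⟨ φ ∣ xs ⊗ g c c' ⟩) ∣ ys' ⟩) ∣ ys ⟩
        ≈⟨ sym (pairing-bilin φ (λ c c' → xs ⊗ g c c') ys ys') ⟩
      ⟨ φ ∣ bilin (λ c c' → xs ⊗ g c c') ys ys' ⟩
        ∎
      where
      open SetoidReasoning setoid
      ψ : (A × C → Carrier) → A → C' → C' → Carrier
      ψ φ a c c' = ⟨ (λ γ → φ (a , γ)) ∣ g c c' ⟩

  module _ {A A' C C' : Set} (f : A' → A' → Lin A) (g : C' → C' → Lin C) where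
    ⊗-interchange : (xs xs' : Lin A') (ys ys' : Lin C') →
      bilin (λ p q → f (proj₁ p) (proj₁ q) ⊗ g (proj₂ p) (proj₂ q)) (xs ⊗ ys) (xs' ⊗ ys')
        ≃ bilin f xs xs' ⊗ bilin g ys ys'
    ⊗-interchange xs xs' ys ys' = by-pairing λ φ → begin
      ⟨ φ ∣ bilin h (xs ⊗ ys) (xs' ⊗ ys') ⟩
        ≈⟨ pairing-bilin φ h (xs ⊗ ys) (xs' ⊗ ys') ⟩
      ⟨ (λ p → ⟨ (λ q → ⟨ φ ∣ h p q ⟩) ∣ xs' ⊗ ys' ⟩) ∣ xs ⊗ ys ⟩
        ≈⟨ pairing-⊗ (λ p → ⟨ (λ q → ⟨ φ ∣ h p q ⟩) ∣ xs' ⊗ ys' ⟩) xs ys ⟩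
      ⟨ (λ a → ⟨ (λ c → ⟨ (λ q → ⟨ φ ∣ h (a , c) q ⟩) ∣ xs' ⊗ ys' ⟩) ∣ ys ⟩) ∣ xs ⟩
        ≈⟨ pairing-cong (λ a → pairing-cong (λ c → pairing-⊗ (λ q → ⟨ φ ∣ h (a , c) q ⟩) xs' ys') ys) xs ⟩
      ⟨ (λ a → ⟨ (λ c → ⟨ (λ a' → ⟨ (λ c' → H φ a a' c c') ∣ ys' ⟩) ∣ xs' ⟩) ∣ ys ⟩) ∣ xs ⟩
        ≈⟨ pairing-cong (λ a → pairing-swap (λ c a' → ⟨ (λ c' → H φ a a' c c') ∣ ys' ⟩) ys xs') xs ⟩
      ⟨ (λ a → ⟨ (λ a' → ⟨ (λ c → ⟨ (λ c' → H φ a a' c c') ∣ ys' ⟩) ∣ ys ⟩) ∣ xs' ⟩) ∣ xs ⟩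
        ≈⟨ sym (pairing-cong (λ a → pairing-cong (λ a' → pairing-bilin φ (λ c c' → f a a' ⊗ g c c') ys ys') xs') xs) ⟩
      ⟨ (λ a → ⟨ (λ a' → ⟨ φ ∣ bilin (λ c c' → f a a' ⊗ g c c') ys ys' ⟩) ∣ xs' ⟩) ∣ xs ⟩
        ≈⟨ sym (pairing-cong (λ a → pairing-cong (λ a' → at (⊗-bilinʳ (f a a') g ys ys') φ) xs') xs) ⟩
      ⟨ (λ a → ⟨ (λ a' → ⟨ φ ∣ f a a' ⊗ bilin g ys ys' ⟩) ∣ xs' ⟩) ∣ xs ⟩
        ≈⟨ sym (pairing-bilin φ (λ a a' → f a a' ⊗ bilin g ys ys') xs xs') ⟩
      ⟨ φ ∣ bilin (λ a a' → f a a' ⊗ bilin g ys ys') xs xs' ⟩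
        ≈⟨ sym (at (⊗-bilinˡ f xs xs' (bilin g ys ys')) φ) ⟩
      ⟨ φ ∣ bilin f xs xs' ⊗ bilin g ys ys' ⟩
        ∎
      where
      open SetoidReasoning setoid
      h : A' × C' → A' × C' → Lin (A × C)
      h p q = f (proj₁ p) (proj₁ q) ⊗ g (proj₂ p) (proj₂ q)
      H : (A × C → Carrier) → A' → A' → C' → C' → Carrier
      H φ a a' c c' = ⟨ φ ∣ f a a' ⊗ g c c' ⟩

  -- Augmented Rota–Baxter algebras and their tensor products

  record AugmentedRotaBaxter (B : Set) : Set (c ⊔ ℓ) where
    field
      _∙_         : B → B → Lin B
      R           : B → Lin B
      unit        : B
      counit      : B → Carrier
      ∙-identityˡ : ∀ b → unit ∙ b ≃ basis b
      ∙-identityʳ : ∀ b → b ∙ unit ≃ basis b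
      counit-∙    : ∀ a b → ⟨ counit ∣ a ∙ b ⟩ ≈ counit a * counit b
      counit-R    : ∀ b → ⟨ counit ∣ R b ⟩ ≈ 0#
      rotaBaxter  : IsRotaBaxterOnBasis _∙_ R

    bilin-identityˡ : (ys : Lin B) → bilin _∙_ (basis unit) ys ≃ ys
    bilin-identityˡ ys = begin
      bilin _∙_ (basis unit) ys  ≈⟨ bilin-basisˡ _∙_ unit ys ⟩
      linExt (unit ∙_) ys        ≈⟨ linExt-cong ∙-identityˡ ys ⟩
      linExt basis ys            ≈⟨ linExt-basis ys ⟩
      ys                         ∎
      where open ≃-Reasoning

    bilin-identityʳ : (xs : Lin B) → bilin _∙_ xs (basis unit) ≃ xs
    bilin-identityʳ xs = begin
      bilin _∙_ xs (basis unit)  ≈⟨ bilin-basisʳ _∙_ xs unit ⟩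
      linExt (_∙ unit) xs        ≈⟨ linExt-cong ∙-identityʳ xs ⟩
      linExt basis xs            ≈⟨ linExt-basis xs ⟩
      xs                         ∎
      where open ≃-Reasoning

    counit-bilin : (xs ys : Lin B) → ⟨ counit ∣ bilin _∙_ xs ys ⟩ ≈ ⟨ counit ∣ xs ⟩ * ⟨ counit ∣ ys ⟩
    counit-bilin xs ys = begin
      ⟨ counit ∣ bilin _∙_ xs ys ⟩
        ≈⟨ pairing-bilin counit _∙_ xs ys ⟩
      ⟨ (λ a → ⟨ (λ b → ⟨ counit ∣ a ∙ b ⟩) ∣ ys ⟩) ∣ xs ⟩
        ≈⟨ pairing-cong (λ a → trans (pairing-cong (counit-∙ a) ys) (pairing-*ˡ (counit a) counit ys)) xs ⟩
      ⟨ (λ a → counit a * ⟨ counit ∣ ys ⟩) ∣ xs ⟩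
        ≈⟨ pairing-*ʳ ⟨ counit ∣ ys ⟩ counit xs ⟩
      ⟨ counit ∣ xs ⟩ * ⟨ counit ∣ ys ⟩
        ∎
      where open SetoidReasoning setoid

    counit-R-bilin : (a : B) (ys : Lin B) → ⟨ counit ∣ bilin _∙_ (R a) ys ⟩ ≈ 0#
    counit-R-bilin a ys = trans (counit-bilin (R a) ys) (trans (*-congʳ (counit-R a)) (zeroˡ _))

    counit-bilin-R : (xs : Lin B) (b : B) → ⟨ counit ∣ bilin _∙_ xs (R b) ⟩ ≈ 0#
    counit-bilin-R xs b = trans (counit-bilin xs (R b)) (trans (*-congˡ (counit-R b)) (zeroʳ _))

  module TensorProduct {A C : Set} (𝒜 : AugmentedRotaBaxter A) (𝒞 : AugmentedRotaBaxter C) where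
    open AugmentedRotaBaxter 𝒜 using () renaming
      ( _∙_ to _∙₁_; R to R₁; unit to 𝟙₁; counit to ε₁; ∙-identityˡ to ∙₁-identityˡ; ∙-identityʳ to ∙₁-identityʳ
      ; counit-∙ to ε₁-∙; counit-R to ε₁-R; rotaBaxter to rotaBaxter₁
      ; bilin-identityˡ to bilin₁-identityˡ; bilin-identityʳ to bilin₁-identityʳ
      ; counit-R-bilin to ε₁-R-bilin; counit-bilin-R to ε₁-bilin-R )
    open AugmentedRotaBaxter 𝒞 using () renaming
      ( _∙_ to _∙₂_; R to R₂; unit to 𝟙₂; counit to ε₂; ∙-identityˡ to ∙₂-identityˡ; ∙-identityʳ to ∙₂-identityʳ
      ; counit-∙ to ε₂-∙; counit-R to ε₂-R; rotaBaxter to rotaBaxter₂ )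

    _∙_ : A × C → A × C → Lin (A × C)
    p ∙ q = (proj₁ p ∙₁ proj₁ q) ⊗ (proj₂ p ∙₂ proj₂ q)

    R : A × C → Lin (A × C)
    R (a , c) = R₁ a ⊗ basis c ++ scale (ε₁ a) (basis 𝟙₁ ⊗ R₂ c)

    counit : A × C → Carrier
    counit p = ε₁ (proj₁ p) * ε₂ (proj₂ p)

    interchange : (xs xs' : Lin A) (ys ys' : Lin C) →
      bilin _∙_ (xs ⊗ ys) (xs' ⊗ ys') ≃ bilin _∙₁_ xs xs' ⊗ bilin _∙₂_ ys ys'
    interchange = ⊗-interchange _∙₁_ _∙₂_

    pairing-R : (φ : A × C → Carrier) (a : A) (c : C) →
      ⟨ φ ∣ R (a , c) ⟩ ≈ ⟨ (λ α → φ (α , c)) ∣ R₁ a ⟩ + ε₁ a * ⟨ (λ γ → φ (𝟙₁ , γ)) ∣ R₂ c ⟩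
    pairing-R φ a c =
      trans (pairing-++-scale φ (R₁ a ⊗ basis c) (ε₁ a) (basis 𝟙₁ ⊗ R₂ c))
        (+-cong (trans (pairing-⊗ φ (R₁ a) (basis c)) (pairing-cong (λ α → pairing-basis (λ γ → φ (α , γ)) c) (R₁ a)))
                (*-congˡ (pairing-basis-⊗ φ 𝟙₁ (R₂ c))))

    linExt-R-⊗ : (xs : Lin A) (ys : Lin C) →
      linExt R (xs ⊗ ys) ≃ linExt R₁ xs ⊗ ys ++ scale ⟨ ε₁ ∣ xs ⟩ (basis 𝟙₁ ⊗ linExt R₂ ys)
    linExt-R-⊗ xs ys = by-pairing λ φ → begin
      ⟨ φ ∣ linExt R (xs ⊗ ys) ⟩
        ≈⟨ pairing-linExt φ R (xs ⊗ ys) ⟩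
      ⟨ (λ p → ⟨ φ ∣ R p ⟩) ∣ xs ⊗ ys ⟩
        ≈⟨ pairing-⊗ (λ p → ⟨ φ ∣ R p ⟩) xs ys ⟩
      ⟨ (λ a → ⟨ (λ c → ⟨ φ ∣ R (a , c) ⟩) ∣ ys ⟩) ∣ xs ⟩
        ≈⟨ pairing-cong (λ a → pairing-cong (λ c → pairing-R φ a c) ys) xs ⟩
      ⟨ (λ a → ⟨ (λ c → U φ a c + ε₁ a * V φ c) ∣ ys ⟩) ∣ xs ⟩
        ≈⟨ pairing-cong (λ a → trans (pairing-+ (U φ a) (λ c → ε₁ a * V φ c) ys)
                                     (+-congˡ (pairing-*ˡ (ε₁ a) (V φ) ys))) xs ⟩
      ⟨ (λ a → ⟨ U φ a ∣ ys ⟩ + ε₁ a * ⟨ V φ ∣ ys ⟩) ∣ xs ⟩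
        ≈⟨ trans (pairing-+ (λ a → ⟨ U φ a ∣ ys ⟩) (λ a → ε₁ a * ⟨ V φ ∣ ys ⟩) xs)
                 (+-congˡ (pairing-*ʳ ⟨ V φ ∣ ys ⟩ ε₁ xs)) ⟩
      ⟨ (λ a → ⟨ U φ a ∣ ys ⟩) ∣ xs ⟩ + ⟨ ε₁ ∣ xs ⟩ * ⟨ V φ ∣ ys ⟩
        ≈⟨ sym (+-cong (pairing-linExt-⊗ φ R₁ xs ys)
                       (*-congˡ (trans (pairing-basis-⊗ φ 𝟙₁ (linExt R₂ ys)) (pairing-linExt (λ γ → φ (𝟙₁ , γ)) R₂ ys)))) ⟩
      ⟨ φ ∣ linExt R₁ xs ⊗ ys ⟩ + ⟨ ε₁ ∣ xs ⟩ * ⟨ φ ∣ basis 𝟙₁ ⊗ linExt R₂ ys ⟩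
        ≈⟨ sym (pairing-++-scale φ (linExt R₁ xs ⊗ ys) ⟨ ε₁ ∣ xs ⟩ (basis 𝟙₁ ⊗ linExt R₂ ys)) ⟩
      ⟨ φ ∣ linExt R₁ xs ⊗ ys ++ scale ⟨ ε₁ ∣ xs ⟩ (basis 𝟙₁ ⊗ linExt R₂ ys) ⟩
        ∎
      where
      open SetoidReasoning setoid
      U : (A × C → Carrier) → A → C → Carrier
      U φ a c = ⟨ (λ α → φ (α , c)) ∣ R₁ a ⟩
      V : (A × C → Carrier) → C → Carrier
      V φ c = ⟨ (λ γ → φ (𝟙₁ , γ)) ∣ R₂ c ⟩

    linExt-R-basis-⊗ : (a : A) (ys : Lin C) →
      linExt R (basis a ⊗ ys) ≃ R₁ a ⊗ ys ++ scale (ε₁ a) (basis 𝟙₁ ⊗ linExt R₂ ys)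
    linExt-R-basis-⊗ a ys =
      ≃-trans (linExt-R-⊗ (basis a) ys)
        (++-cong (⊗-congˡ ys (linExt-extends R₁ a)) (scale-congˡ (pairing-basis ε₁ a) (basis 𝟙₁ ⊗ linExt R₂ ys)))

    linExt-R-⊗-ker : (xs : Lin A) (ys : Lin C) → ⟨ ε₁ ∣ xs ⟩ ≈ 0# → linExt R (xs ⊗ ys) ≃ linExt R₁ xs ⊗ ys
    linExt-R-⊗-ker xs ys ε₁xs≈0 = begin
      linExt R (xs ⊗ ys)
        ≈⟨ linExt-R-⊗ xs ys ⟩
      linExt R₁ xs ⊗ ys ++ scale ⟨ ε₁ ∣ xs ⟩ (basis 𝟙₁ ⊗ linExt R₂ ys)
        ≈⟨ ++-congʳ (linExt R₁ xs ⊗ ys) (scale-zero (basis 𝟙₁ ⊗ linExt R₂ ys) ε₁xs≈0) ⟩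
      linExt R₁ xs ⊗ ys ++ []
        ≡⟨ ++-identityʳ (linExt R₁ xs ⊗ ys) ⟩
      linExt R₁ xs ⊗ ys
        ∎
      where open ≃-Reasoning

    module BasisProducts (a a' : A) (c c' : C) where
      𝟙 : Lin A
      𝟙 = basis 𝟙₁

      e e' : Carrier
      e  = ε₁ a
      e' = ε₁ a'

      P₁ P₂ P₃ : Lin A
      P₁ = bilin _∙₁_ (R₁ a) (basis a')
      P₂ = bilin _∙₁_ (basis a) (R₁ a')
      P₃ = a ∙₁ a'

      M N₁ N₂ : Lin C
      M  = c ∙₂ c'
      N₁ = bilin _∙₂_ (R₂ c) (basis c')
      N₂ = bilin _∙₂_ (basis c) (R₂ c')

      product-RR : bilin _∙_ (R₁ a ⊗ basis c) (R₁ a' ⊗ basis c')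
        ≃ rbSum (linExt R₁ P₁ ⊗ M) (linExt R₁ P₂ ⊗ M) (linExt R₁ P₃ ⊗ M)
      product-RR = begin
        bilin _∙_ (R₁ a ⊗ basis c) (R₁ a' ⊗ basis c')
          ≈⟨ interchange (R₁ a) (R₁ a') (basis c) (basis c') ⟩
        bilin _∙₁_ (R₁ a) (R₁ a') ⊗ bilin _∙₂_ (basis c) (basis c')
          ≈⟨ ⊗-cong (rotaBaxter₁ a a') (bilin-basis _∙₂_ c c') ⟩
        linExt R₁ (rbSum P₁ P₂ P₃) ⊗ M
          ≈⟨ ⊗-congˡ M (linExt-rbSum R₁ P₁ P₂ P₃) ⟩
        rbSum (linExt R₁ P₁) (linExt R₁ P₂) (linExt R₁ P₃) ⊗ M
          ≈⟨ bilin-rbSumˡ (λ α γ → basis (α , γ)) (linExt R₁ P₁) (linExt R₁ P₂) (linExt R₁ P₃) M ⟩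
        rbSum (linExt R₁ P₁ ⊗ M) (linExt R₁ P₂ ⊗ M) (linExt R₁ P₃ ⊗ M)
          ∎
        where open ≃-Reasoning

      product-R𝟙 : bilin _∙_ (R₁ a ⊗ basis c) (𝟙 ⊗ R₂ c') ≃ R₁ a ⊗ N₂
      product-R𝟙 = ≃-trans (interchange (R₁ a) 𝟙 (basis c) (R₂ c')) (⊗-congˡ N₂ (bilin₁-identityʳ (R₁ a)))

      product-𝟙R : bilin _∙_ (𝟙 ⊗ R₂ c) (R₁ a' ⊗ basis c') ≃ R₁ a' ⊗ N₁
      product-𝟙R = ≃-trans (interchange 𝟙 (R₁ a') (R₂ c) (basis c')) (⊗-congˡ N₁ (bilin₁-identityˡ (R₁ a')))

      product-𝟙𝟙 : bilin _∙_ (𝟙 ⊗ R₂ c) (𝟙 ⊗ R₂ c')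
        ≃ rbSum (𝟙 ⊗ linExt R₂ N₁) (𝟙 ⊗ linExt R₂ N₂) (𝟙 ⊗ linExt R₂ M)
      product-𝟙𝟙 = begin
        bilin _∙_ (𝟙 ⊗ R₂ c) (𝟙 ⊗ R₂ c')
          ≈⟨ interchange 𝟙 𝟙 (R₂ c) (R₂ c') ⟩
        bilin _∙₁_ 𝟙 𝟙 ⊗ bilin _∙₂_ (R₂ c) (R₂ c')
          ≈⟨ ⊗-cong (bilin₁-identityˡ 𝟙) (rotaBaxter₂ c c') ⟩
        𝟙 ⊗ linExt R₂ (rbSum N₁ N₂ M)
          ≈⟨ ⊗-congʳ 𝟙 (linExt-rbSum R₂ N₁ N₂ M) ⟩
        𝟙 ⊗ rbSum (linExt R₂ N₁) (linExt R₂ N₂) (linExt R₂ M)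
          ≈⟨ bilin-rbSumʳ (λ α γ → basis (α , γ)) 𝟙 (linExt R₂ N₁) (linExt R₂ N₂) (linExt R₂ M) ⟩
        rbSum (𝟙 ⊗ linExt R₂ N₁) (𝟙 ⊗ linExt R₂ N₂) (𝟙 ⊗ linExt R₂ M)
          ∎
        where open ≃-Reasoning

      product-R-basis : bilin _∙_ (R (a , c)) (basis (a' , c')) ≃ P₁ ⊗ M ++ scale e (basis a' ⊗ N₁)
      product-R-basis = begin
        bilin _∙_ (R (a , c)) (basis (a' , c'))
          ≈⟨ bilin-congʳ _∙_ (R (a , c)) (≃-sym (basis-⊗ a' c')) ⟩
        bilin _∙_ (R₁ a ⊗ basis c ++ scale e (𝟙 ⊗ R₂ c)) q
          ≡⟨ bilin-++ˡ _∙_ (R₁ a ⊗ basis c) (scale e (𝟙 ⊗ R₂ c)) q ⟩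
        bilin _∙_ (R₁ a ⊗ basis c) q ++ bilin _∙_ (scale e (𝟙 ⊗ R₂ c)) q
          ≈⟨ ++-congʳ (bilin _∙_ (R₁ a ⊗ basis c) q) (bilin-scaleˡ _∙_ e (𝟙 ⊗ R₂ c) q) ⟩
        bilin _∙_ (R₁ a ⊗ basis c) q ++ scale e (bilin _∙_ (𝟙 ⊗ R₂ c) q)
          ≈⟨ ++-cong (interchange (R₁ a) (basis a') (basis c) (basis c'))
                     (scale-cong e (interchange 𝟙 (basis a') (R₂ c) (basis c'))) ⟩
        P₁ ⊗ bilin _∙₂_ (basis c) (basis c') ++ scale e (bilin _∙₁_ 𝟙 (basis a') ⊗ N₁)
          ≈⟨ ++-cong (⊗-congʳ P₁ (bilin-basis _∙₂_ c c')) (scale-cong e (⊗-congˡ N₁ (bilin₁-identityˡ (basis a')))) ⟩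
        P₁ ⊗ M ++ scale e (basis a' ⊗ N₁)
          ∎
        where
        open ≃-Reasoning
        q : Lin (A × C)
        q = basis a' ⊗ basis c'

      product-basis-R : bilin _∙_ (basis (a , c)) (R (a' , c')) ≃ P₂ ⊗ M ++ scale e' (basis a ⊗ N₂)
      product-basis-R = begin
        bilin _∙_ (basis (a , c)) (R (a' , c'))
          ≈⟨ bilin-congˡ _∙_ (R (a' , c')) (≃-sym (basis-⊗ a c)) ⟩
        bilin _∙_ p (R₁ a' ⊗ basis c' ++ scale e' (𝟙 ⊗ R₂ c'))
          ≈⟨ bilin-++ʳ _∙_ p (R₁ a' ⊗ basis c') (scale e' (𝟙 ⊗ R₂ c')) ⟩
        bilin _∙_ p (R₁ a' ⊗ basis c') ++ bilin _∙_ p (scale e' (𝟙 ⊗ R₂ c'))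
          ≈⟨ ++-congʳ (bilin _∙_ p (R₁ a' ⊗ basis c')) (bilin-scaleʳ _∙_ e' p (𝟙 ⊗ R₂ c')) ⟩
        bilin _∙_ p (R₁ a' ⊗ basis c') ++ scale e' (bilin _∙_ p (𝟙 ⊗ R₂ c'))
          ≈⟨ ++-cong (interchange (basis a) (R₁ a') (basis c) (basis c'))
                     (scale-cong e' (interchange (basis a) 𝟙 (basis c) (R₂ c'))) ⟩
        P₂ ⊗ bilin _∙₂_ (basis c) (basis c') ++ scale e' (bilin _∙₁_ (basis a) 𝟙 ⊗ N₂)
          ≈⟨ ++-cong (⊗-congʳ P₂ (bilin-basis _∙₂_ c c')) (scale-cong e' (⊗-congˡ N₂ (bilin₁-identityʳ (basis a)))) ⟩
        P₂ ⊗ M ++ scale e' (basis a ⊗ N₂)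
          ∎
        where
        open ≃-Reasoning
        p : Lin (A × C)
        p = basis a ⊗ basis c

      R-product-R-basis : linExt R (bilin _∙_ (R (a , c)) (basis (a' , c')))
        ≃ linExt R₁ P₁ ⊗ M ++ scale e (R₁ a' ⊗ N₁ ++ scale e' (𝟙 ⊗ linExt R₂ N₁))
      R-product-R-basis = begin
        linExt R (bilin _∙_ (R (a , c)) (basis (a' , c')))
          ≈⟨ linExt-congʳ R product-R-basis ⟩
        linExt R (P₁ ⊗ M ++ scale e (basis a' ⊗ N₁))
          ≡⟨ linExt-++ R (P₁ ⊗ M) (scale e (basis a' ⊗ N₁)) ⟩
        linExt R (P₁ ⊗ M) ++ linExt R (scale e (basis a' ⊗ N₁))
          ≈⟨ ++-cong (linExt-R-⊗-ker P₁ M (ε₁-R-bilin a (basis a')))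
                     (≃-trans (linExt-scale R e (basis a' ⊗ N₁)) (scale-cong e (linExt-R-basis-⊗ a' N₁))) ⟩
        linExt R₁ P₁ ⊗ M ++ scale e (R₁ a' ⊗ N₁ ++ scale e' (𝟙 ⊗ linExt R₂ N₁))
          ∎
        where open ≃-Reasoning

      R-product-basis-R : linExt R (bilin _∙_ (basis (a , c)) (R (a' , c')))
        ≃ linExt R₁ P₂ ⊗ M ++ scale e' (R₁ a ⊗ N₂ ++ scale e (𝟙 ⊗ linExt R₂ N₂))
      R-product-basis-R = begin
        linExt R (bilin _∙_ (basis (a , c)) (R (a' , c')))
          ≈⟨ linExt-congʳ R product-basis-R ⟩
        linExt R (P₂ ⊗ M ++ scale e' (basis a ⊗ N₂))
          ≡⟨ linExt-++ R (P₂ ⊗ M) (scale e' (basis a ⊗ N₂)) ⟩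
        linExt R (P₂ ⊗ M) ++ linExt R (scale e' (basis a ⊗ N₂))
          ≈⟨ ++-cong (linExt-R-⊗-ker P₂ M (ε₁-bilin-R (basis a) a'))
                     (≃-trans (linExt-scale R e' (basis a ⊗ N₂)) (scale-cong e' (linExt-R-basis-⊗ a N₂))) ⟩
        linExt R₁ P₂ ⊗ M ++ scale e' (R₁ a ⊗ N₂ ++ scale e (𝟙 ⊗ linExt R₂ N₂))
          ∎
        where open ≃-Reasoning

      R-product : linExt R ((a , c) ∙ (a' , c')) ≃ linExt R₁ P₃ ⊗ M ++ scale (e * e') (𝟙 ⊗ linExt R₂ M)
      R-product =
        ≃-trans (linExt-R-⊗ P₃ M) (++-congʳ (linExt R₁ P₃ ⊗ M) (scale-congˡ (ε₁-∙ a a') (𝟙 ⊗ linExt R₂ M)))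

      B₁₁ B₁₂ B₂₁ B₂₂ : Lin (A × C)
      B₁₁ = bilin _∙_ (R₁ a ⊗ basis c) (R₁ a' ⊗ basis c')
      B₁₂ = bilin _∙_ (R₁ a ⊗ basis c) (𝟙 ⊗ R₂ c')
      B₂₁ = bilin _∙_ (𝟙 ⊗ R₂ c) (R₁ a' ⊗ basis c')
      B₂₂ = bilin _∙_ (𝟙 ⊗ R₂ c) (𝟙 ⊗ R₂ c')

      module _ (φ : A × C → Carrier) where
        -- the eight tensors into which both sides of the identity expand
        α₁ α₂ α₃ β₁ β₂ γ₁ γ₂ γ₃ : Carrier
        α₁ = ⟨ φ ∣ linExt R₁ P₁ ⊗ M ⟩
        α₂ = ⟨ φ ∣ linExt R₁ P₂ ⊗ M ⟩
        α₃ = ⟨ φ ∣ linExt R₁ P₃ ⊗ M ⟩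
        β₁ = ⟨ φ ∣ R₁ a' ⊗ N₁ ⟩
        β₂ = ⟨ φ ∣ R₁ a ⊗ N₂ ⟩
        γ₁ = ⟨ φ ∣ 𝟙 ⊗ linExt R₂ N₁ ⟩
        γ₂ = ⟨ φ ∣ 𝟙 ⊗ linExt R₂ N₂ ⟩
        γ₃ = ⟨ φ ∣ 𝟙 ⊗ linExt R₂ M ⟩

        pairing-nested : (xs : Lin (A × C)) (s : Carrier) (ys : Lin (A × C)) (t : Carrier) (zs : Lin (A × C)) →
          ⟨ φ ∣ xs ++ scale s (ys ++ scale t zs) ⟩ ≈ ⟨ φ ∣ xs ⟩ + s * (⟨ φ ∣ ys ⟩ + t * ⟨ φ ∣ zs ⟩)
        pairing-nested xs s ys t zs =
          trans (pairing-++-scale φ xs s (ys ++ scale t zs)) (+-congˡ (*-congˡ (pairing-++-scale φ ys t zs)))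

        pairing-lhs : ⟨ φ ∣ bilin _∙_ (R (a , c)) (R (a' , c')) ⟩
          ≈ ((α₁ + (α₂ + w * α₃)) + e' * β₂) + e * (β₁ + e' * (γ₁ + (γ₂ + w * γ₃)))
        pairing-lhs = begin
          ⟨ φ ∣ bilin _∙_ (R (a , c)) (R (a' , c')) ⟩
            ≈⟨ at (bilin-expand _∙_ (R₁ a ⊗ basis c) (𝟙 ⊗ R₂ c) e (R₁ a' ⊗ basis c') (𝟙 ⊗ R₂ c') e') φ ⟩
          ⟨ φ ∣ (B₁₁ ++ scale e' B₁₂) ++ scale e (B₂₁ ++ scale e' B₂₂) ⟩
            ≈⟨ trans (pairing-nested (B₁₁ ++ scale e' B₁₂) e B₂₁ e' B₂₂) (+-congʳ (pairing-++-scale φ B₁₁ e' B₁₂)) ⟩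
          (⟨ φ ∣ B₁₁ ⟩ + e' * ⟨ φ ∣ B₁₂ ⟩) + e * (⟨ φ ∣ B₂₁ ⟩ + e' * ⟨ φ ∣ B₂₂ ⟩)
            ≈⟨ +-cong (+-cong (trans (at product-RR φ)
                                     (pairing-rbSum φ (linExt R₁ P₁ ⊗ M) (linExt R₁ P₂ ⊗ M) (linExt R₁ P₃ ⊗ M)))
                              (*-congˡ (at product-R𝟙 φ)))
                      (*-congˡ (+-cong (at product-𝟙R φ)
                                       (*-congˡ (trans (at product-𝟙𝟙 φ)
                                                       (pairing-rbSum φ (𝟙 ⊗ linExt R₂ N₁) (𝟙 ⊗ linExt R₂ N₂)
                                                                        (𝟙 ⊗ linExt R₂ M)))))) ⟩
          ((α₁ + (α₂ + w * α₃)) + e' * β₂) + e * (β₁ + e' * (γ₁ + (γ₂ + w * γ₃)))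
            ∎
          where open SetoidReasoning setoid

        pairing-rhs :
          ⟨ φ ∣ linExt R (rbSum (bilin _∙_ (R (a , c)) (basis (a' , c')))
                                (bilin _∙_ (basis (a , c)) (R (a' , c'))) ((a , c) ∙ (a' , c'))) ⟩
          ≈ (α₁ + e * (β₁ + e' * γ₁)) + ((α₂ + e' * (β₂ + e * γ₂)) + w * (α₃ + (e * e') * γ₃))
        pairing-rhs = begin
          ⟨ φ ∣ linExt R (rbSum Q₁ Q₂ Q₃) ⟩
            ≈⟨ at (linExt-rbSum R Q₁ Q₂ Q₃) φ ⟩
          ⟨ φ ∣ rbSum (linExt R Q₁) (linExt R Q₂) (linExt R Q₃) ⟩
            ≈⟨ pairing-rbSum φ (linExt R Q₁) (linExt R Q₂) (linExt R Q₃) ⟩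
          ⟨ φ ∣ linExt R Q₁ ⟩ + (⟨ φ ∣ linExt R Q₂ ⟩ + w * ⟨ φ ∣ linExt R Q₃ ⟩)
            ≈⟨ +-cong (trans (at R-product-R-basis φ)
                             (pairing-nested (linExt R₁ P₁ ⊗ M) e (R₁ a' ⊗ N₁) e' (𝟙 ⊗ linExt R₂ N₁)))
                      (+-cong (trans (at R-product-basis-R φ)
                                     (pairing-nested (linExt R₁ P₂ ⊗ M) e' (R₁ a ⊗ N₂) e (𝟙 ⊗ linExt R₂ N₂)))
                              (*-congˡ (trans (at R-product φ)
                                              (pairing-++-scale φ (linExt R₁ P₃ ⊗ M) (e * e') (𝟙 ⊗ linExt R₂ M))))) ⟩
          (α₁ + e * (β₁ + e' * γ₁)) + ((α₂ + e' * (β₂ + e * γ₂)) + w * (α₃ + (e * e') * γ₃))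
            ∎
          where
          open SetoidReasoning setoid
          Q₁ Q₂ Q₃ : Lin (A × C)
          Q₁ = bilin _∙_ (R (a , c)) (basis (a' , c'))
          Q₂ = bilin _∙_ (basis (a , c)) (R (a' , c'))
          Q₃ = (a , c) ∙ (a' , c')

    rotaBaxter : IsRotaBaxterOnBasis _∙_ R
    rotaBaxter (a , c) (a' , c') = by-pairing λ φ →
      trans (pairing-lhs φ)
        (trans (normal-forms (α₁ φ) (α₂ φ) (α₃ φ) (β₁ φ) (β₂ φ) (γ₁ φ) (γ₂ φ) (γ₃ φ) e e' w) (sym (pairing-rhs φ)))
      where
      open BasisProducts a a' c c'
      normal-forms : ∀ α₁ α₂ α₃ β₁ β₂ γ₁ γ₂ γ₃ e e' w →
        ((α₁ + (α₂ + w * α₃)) + e' * β₂) + e * (β₁ + e' * (γ₁ + (γ₂ + w * γ₃)))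
          ≈ (α₁ + e * (β₁ + e' * γ₁)) + ((α₂ + e' * (β₂ + e * γ₂)) + w * (α₃ + (e * e') * γ₃))
      normal-forms = solve 11 (λ α₁ α₂ α₃ β₁ β₂ γ₁ γ₂ γ₃ e e' w →
        ((α₁ :+ (α₂ :+ w :* α₃)) :+ e' :* β₂) :+ e :* (β₁ :+ e' :* (γ₁ :+ (γ₂ :+ w :* γ₃)))
          := (α₁ :+ e :* (β₁ :+ e' :* γ₁)) :+ ((α₂ :+ e' :* (β₂ :+ e :* γ₂)) :+ w :* (α₃ :+ (e :* e') :* γ₃))) refl

    tensor : AugmentedRotaBaxter (A × C)
    tensor = record
      { _∙_         = _∙_
      ; R           = R
      ; unit        = 𝟙₁ , 𝟙₂
      ; counit      = counit
      ; ∙-identityˡ = λ { (a , c) → ≃-trans (⊗-cong (∙₁-identityˡ a) (∙₂-identityˡ c)) (basis-⊗ a c) }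
      ; ∙-identityʳ = λ { (a , c) → ≃-trans (⊗-cong (∙₁-identityʳ a) (∙₂-identityʳ c)) (basis-⊗ a c) }
      ; counit-∙    = λ { (a , c) (a' , c') →
          trans (pairing-⊗-product ε₁ ε₂ (a ∙₁ a') (c ∙₂ c'))
            (trans (*-cong (ε₁-∙ a a') (ε₂-∙ c c')) (*-interchange (ε₁ a) (ε₁ a') (ε₂ c) (ε₂ c'))) }
      ; counit-R    = λ { (a , c) → counit-R a c }
      ; rotaBaxter  = rotaBaxter
      }
      where
      counit-R : (a : A) (c : C) → ⟨ counit ∣ R (a , c) ⟩ ≈ 0#
      counit-R a c = begin
        ⟨ counit ∣ R (a , c) ⟩
          ≈⟨ pairing-++-scale counit (R₁ a ⊗ basis c) (ε₁ a) (basis 𝟙₁ ⊗ R₂ c) ⟩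
        ⟨ counit ∣ R₁ a ⊗ basis c ⟩ + ε₁ a * ⟨ counit ∣ basis 𝟙₁ ⊗ R₂ c ⟩
          ≈⟨ +-cong (pairing-⊗-product ε₁ ε₂ (R₁ a) (basis c)) (*-congˡ (pairing-⊗-product ε₁ ε₂ (basis 𝟙₁) (R₂ c))) ⟩
        ⟨ ε₁ ∣ R₁ a ⟩ * ⟨ ε₂ ∣ basis c ⟩ + ε₁ a * (⟨ ε₁ ∣ basis 𝟙₁ ⟩ * ⟨ ε₂ ∣ R₂ c ⟩)
          ≈⟨ +-cong (trans (*-congʳ (ε₁-R a)) (zeroˡ _)) (trans (*-congˡ (trans (*-congˡ (ε₂-R c)) (zeroʳ _))) (zeroʳ _)) ⟩
        0# + 0#
          ≈⟨ +-identityˡ 0# ⟩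
        0#
          ∎
        where open SetoidReasoning setoid

  -- Planar rooted forests with decorated angles

  ⋄F-identityˡ : (G : Forest) → • ⋄F G ≡.≡ basis G
  ⋄F-identityˡ (one t)      = ≡.refl
  ⋄F-identityˡ (cons t y G) = ≡.refl

  ⋄F-identityʳ : (F : Forest) → F ⋄F • ≡.≡ basis F
  ⋄F-identityʳ (one leaf)     = ≡.refl
  ⋄F-identityʳ (one (node A)) = ≡.refl
  ⋄F-identityʳ (cons t x F)   = ≡.cong (lmap (cons t x)) (⋄F-identityʳ F)

  ⋄FT≡⋄F : (F : Forest) (t : Tree) → F ⋄FT t ≡.≡ F ⋄F one t
  ⋄FT≡⋄F (one s)      t = ≡.refl
  ⋄FT≡⋄F (cons s x F) t = ≡.cong (lmap (cons s x)) (⋄FT≡⋄F F t)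

  B⁺-⋄F-B⁺ : (F G : Forest) → B⁺ F ⋄F B⁺ G ≃ lmap B⁺ (rbSum (B⁺ F ⋄F G) (F ⋄F B⁺ G) (F ⋄F G))
  B⁺-⋄F-B⁺ F G = by-pairing λ φ → begin
    ⟨ φ ∣ lmap one (rbSum (lmap node X) (lmap node Y) (lmap node Z)) ⟩
      ≡⟨ pairing-lmap φ one (rbSum (lmap node X) (lmap node Y) (lmap node Z)) ⟩
    ⟨ (λ t → φ (one t)) ∣ rbSum (lmap node X) (lmap node Y) (lmap node Z) ⟩
      ≈⟨ pairing-rbSum (λ t → φ (one t)) (lmap node X) (lmap node Y) (lmap node Z) ⟩
    ⟨ (λ t → φ (one t)) ∣ lmap node X ⟩ + (⟨ (λ t → φ (one t)) ∣ lmap node Y ⟩ + w * ⟨ (λ t → φ (one t)) ∣ lmap node Z ⟩)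
      ≡⟨ ≡.cong₂ _+_ (pairing-lmap _ node X) (≡.cong₂ (λ u v → u + w * v) (pairing-lmap _ node Y) (pairing-lmap _ node Z)) ⟩
    ⟨ (λ H → φ (B⁺ H)) ∣ X ⟩ + (⟨ (λ H → φ (B⁺ H)) ∣ Y ⟩ + w * ⟨ (λ H → φ (B⁺ H)) ∣ Z ⟩)
      ≈⟨ sym (pairing-rbSum (λ H → φ (B⁺ H)) X Y Z) ⟩
    ⟨ (λ H → φ (B⁺ H)) ∣ rbSum X Y Z ⟩
      ≡⟨ ≡.sym (pairing-lmap φ B⁺ (rbSum X Y Z)) ⟩
    ⟨ φ ∣ lmap B⁺ (rbSum X Y Z) ⟩
      ≡⟨ ≡.cong (λ Y' → ⟨ φ ∣ lmap B⁺ (rbSum X Y' Z) ⟩) (⋄FT≡⋄F F (node G)) ⟩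
    ⟨ φ ∣ lmap B⁺ (rbSum (B⁺ F ⋄F G) (F ⋄F B⁺ G) (F ⋄F G)) ⟩
      ∎
    where
    open SetoidReasoning setoid
    X Y Z : Lin Forest
    X = node F ⋄TF G
    Y = F ⋄FT node G
    Z = F ⋄F G

  ⋄F-rotaBaxter : IsRotaBaxterOnBasis _⋄F_ (λ F → basis (B⁺ F))
  ⋄F-rotaBaxter F G = begin
    bilin _⋄F_ (basis (B⁺ F)) (basis (B⁺ G))
      ≈⟨ bilin-basis _⋄F_ (B⁺ F) (B⁺ G) ⟩
    B⁺ F ⋄F B⁺ G
      ≈⟨ B⁺-⋄F-B⁺ F G ⟩
    lmap B⁺ (rbSum (B⁺ F ⋄F G) (F ⋄F B⁺ G) (F ⋄F G))
      ≈⟨ lmap-cong B⁺ (rbSum-cong (≃-sym (bilin-basis _⋄F_ (B⁺ F) G)) (≃-sym (bilin-basis _⋄F_ F (B⁺ G)))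
                                  (≃-refl {x = F ⋄F G})) ⟩
    lmap B⁺ ρ
      ≈⟨ ≃-sym (linExt-basis-lmap B⁺ ρ) ⟩
    linExt (λ H → basis (B⁺ H)) ρ
      ∎
    where
    open ≃-Reasoning
    ρ : Lin Forest
    ρ = rbSum (bilin _⋄F_ (basis (B⁺ F)) (basis G)) (bilin _⋄F_ (basis F) (basis (B⁺ G))) (F ⋄F G)

  ε-lmap-zero : {B : Set} (g : B → Forest) → (∀ b → ε (g b) ≡.≡ 0#) → (xs : Lin B) → ⟨ ε ∣ lmap g xs ⟩ ≈ 0#
  ε-lmap-zero g εg≡0 xs =
    trans (reflexive (pairing-lmap ε g xs)) (trans (pairing-cong (λ b → reflexive (εg≡0 b)) xs) (pairing-zero xs))

  ε-⋄F : (F G : Forest) → ⟨ ε ∣ F ⋄F G ⟩ ≈ ε F * ε G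
  ε-⋄F (one leaf)     G              =
    trans (reflexive (≡.cong ⟨ ε ∣_⟩ (⋄F-identityˡ G))) (trans (pairing-basis ε G) (sym (*-identityˡ _)))
  ε-⋄F (one (node A)) (one leaf)     = trans (pairing-basis ε (B⁺ A)) (sym (zeroˡ 1#))
  ε-⋄F (one (node A)) (one (node B)) =
    trans (at (B⁺-⋄F-B⁺ A B) ε)
      (trans (ε-lmap-zero B⁺ (λ _ → ≡.refl) (rbSum (B⁺ A ⋄F B) (A ⋄F B⁺ B) (A ⋄F B))) (sym (zeroˡ 0#)))
  ε-⋄F (one (node A)) (cons t y G)   =
    trans (ε-lmap-zero (λ s → cons s y G) (λ _ → ≡.refl) (node A ⋄T t)) (sym (zeroˡ 0#))
  ε-⋄F (cons t x F)   G              = trans (ε-lmap-zero (cons t x) (λ _ → ≡.refl) (F ⋄F G)) (sym (zeroˡ _))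

  adf : AugmentedRotaBaxter Forest
  adf = record
    { _∙_         = _⋄F_
    ; R           = λ F → basis (B⁺ F)
    ; unit        = •
    ; counit      = ε
    ; ∙-identityˡ = λ G → ≡⇒≃ (⋄F-identityˡ G)
    ; ∙-identityʳ = λ F → ≡⇒≃ (⋄F-identityʳ F)
    ; counit-∙    = ε-⋄F
    ; counit-R    = λ F → pairing-basis ε (B⁺ F)
    ; rotaBaxter  = ⋄F-rotaBaxter
    }

  adf³ : AugmentedRotaBaxter Triple
  adf³ = TensorProduct.tensor adf (TensorProduct.tensor adf adf)

  R-adf³≃R3basis : (t : Triple) → AugmentedRotaBaxter.R adf³ t ≃ R3basis t
  R-adf³≃R3basis (F , G , H) = by-pairing λ φ → begin
    ⟨ φ ∣ AugmentedRotaBaxter.R adf³ (F , G , H) ⟩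
      ≈⟨ TensorProduct.pairing-R adf (TensorProduct.tensor adf adf) φ F (G , H) ⟩
    ⟨ (λ α → φ (α , G , H)) ∣ basis (B⁺ F) ⟩ + ε F * ⟨ (λ γ → φ (• , γ)) ∣ TensorProduct.R adf adf (G , H) ⟩
      ≈⟨ +-cong (pairing-basis (λ α → φ (α , G , H)) (B⁺ F))
                (*-congˡ (TensorProduct.pairing-R adf adf (λ γ → φ (• , γ)) G H)) ⟩
    φ (B⁺ F , G , H)
      + ε F * (⟨ (λ β → φ (• , β , H)) ∣ basis (B⁺ G) ⟩ + ε G * ⟨ (λ γ → φ (• , • , γ)) ∣ basis (B⁺ H) ⟩)
      ≈⟨ +-congˡ (*-congˡ (+-cong (pairing-basis (λ β → φ (• , β , H)) (B⁺ G))
                                  (*-congˡ (pairing-basis (λ γ → φ (• , • , γ)) (B⁺ H))))) ⟩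
    φ (B⁺ F , G , H) + ε F * (φ (• , B⁺ G , H) + ε G * φ (• , • , B⁺ H))
      ≈⟨ expand (φ (B⁺ F , G , H)) (ε F) (φ (• , B⁺ G , H)) (ε G) (φ (• , • , B⁺ H)) ⟩
    ⟨ φ ∣ R3basis (F , G , H) ⟩
      ∎
    where
    open SetoidReasoning setoid
    expand : ∀ x e y f z → x + e * (y + f * z) ≈ 1# * x + (e * y + (e * f * z + 0#))
    expand = solve 5 (λ x e y f z → x :+ e :* (y :+ f :* z) := con 1 :* x :+ (e :* y :+ (e :* f :* z :+ con 0))) refl

  -- _⋄3_ is definitionally the product of adf³, so only the operators need to be matched.
  isRotaBaxter-R3 : IsRotaBaxter _⋄3_ R3basis
  isRotaBaxter-R3 = isRotaBaxter-cong R-adf³≃R3basis (isRotaBaxter (AugmentedRotaBaxter.rotaBaxter adf³))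

  ε-relabelF : (σ : ℕ → ℕ) (F : Forest) → ε (relabelF σ F) ≡.≡ ε F
  ε-relabelF σ (one leaf)     = ≡.refl
  ε-relabelF σ (one (node A)) = ≡.refl
  ε-relabelF σ (cons t x F)   = ≡.refl

  R3basis-relabel : (σ : ℕ → ℕ) (t : Triple) → R3basis (relabel3 σ t) ≡.≡ lmap (relabel3 σ) (R3basis t)
  R3basis-relabel σ (F , G , H) rewrite ε-relabelF σ F | ε-relabelF σ G = ≡.refl

  R3-natural : (σ : ℕ → ℕ) (xs : Lin Triple) →
    linExt R3basis (lmap (relabel3 σ) xs) ≃ lmap (relabel3 σ) (linExt R3basis xs)
  R3-natural σ = linExt-natural (relabel3 σ) R3basis (λ t → ≡⇒≃ (R3basis-relabel σ t))

  δ : Triple → Triple → Carrier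
  δ t t' with t' ≟3 t
  ... | yes _ = 1#
  ... | no _  = 0#

  coeff≈pairing-δ : (t : Triple) (xs : Lin Triple) → coeff _≟3_ t xs ≈ ⟨ δ t ∣ xs ⟩
  coeff≈pairing-δ t []              = refl
  coeff≈pairing-δ t ((k , t') ∷ xs) with t' ≟3 t
  ... | yes _ = +-cong (sym (*-identityʳ k)) (coeff≈pairing-δ t xs)
  ... | no _  = trans (coeff≈pairing-δ t xs) (trans (sym (+-identityˡ _)) (+-congʳ (sym (zeroʳ k))))

  ≃⇒≈3 : {xs ys : Lin Triple} → xs ≃ ys → xs ≈3 ys
  ≃⇒≈3 {xs} {ys} xs≃ys t = trans (coeff≈pairing-δ t xs) (trans (at xs≃ys (δ t)) (sym (coeff≈pairing-δ t ys)))

-- The two identities hold for arbitrary linear combinations over any commutative ring.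
proposition3p4 : {c ℓ : Level} (K : CommutativeRing c ℓ) → IsFieldChar0 K →
    (w : CommutativeRing.Carrier K) →
    let open ADF K w in
    -- R⁽³⁾ is a morphism of species (natural in bijections X → X')
    ((X X' : List ℕ) → Unique X → Unique X' → (σ : ℕ → ℕ) → map σ X ↭ X' →
      (x : Lin Triple) → InComponent X x →
      R3 (lmap (relabel3 σ) x) ≈3 lmap (relabel3 σ) (R3 x))
    ×
    -- Rota–Baxter identity of weight w
    ((X Y : List ℕ) → Unique (X ++ Y) → (x y : Lin Triple) →
      InComponent X x → InComponent Y y →
      mult3 (R3 x) (R3 y)
        ≈3 R3 (mult3 (R3 x) y ++ mult3 x (R3 y) ++ scale w (mult3 x y)))
proposition3p4 K _ w =
  (λ _ _ _ _ σ _ x _ → ≃⇒≈3 K w (R3-natural K w σ x)) ,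
  (λ _ _ _ x y _ _ → ≃⇒≈3 K w (isRotaBaxter-R3 K w x y))
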